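{- Let $n\ge4$ and let $W''_n$ be the directed wheel graph on vertices $v_1$ (the axle) and $v_2,\dots,v_n$ (the rim), where the rim cycle $v_2,v_3,\dots,v_n,v_2$ consists of bi-directional arrows and each spoke is a one-directional arrow $v_1\to v_i$ ($2\le i\le n$). Then the Smith normal form of the Laplacian $L_{W''_n}$ is the diagonal matrix $\operatorname{diag}(1,\dots,1,a,b,0)$ with $n-3$ entries equal to $1$, where $(a,b)=(n-1,n-1)$ if $n$ is even and $(a,b)=\big(\tfrac{n-1}{2},2(n-1)\big)$ if $n$ is odd. Consequently $\operatorname{Pic}(W''_n)\cong\mathbb{Z}\times\mathbb{Z}_{n-1}\times\mathbb{Z}_{n-1}$ if $n$ is even and $\operatorname{Pic}(W''_n)\cong\mathbb{Z}\times\mathbb{Z}_{(n-1)/2}\times\mathbb{Z}_{2(n-1)}$ if $n$ is odd.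
   Context: A bi-directional arrow between $u,w$ counts as an arrow from $u$ to $w$ and one from $w$ to $u$. The Laplacian $L_G$ of a directed graph on $v_1,\dots,v_n$ is the $n\times n$ integer matrix with $(i,i)$ entry the number of outgoing arrows of $v_i$ and $(i,j)$ entry ($i\ne j$) minus the number of arrows from $v_i$ to $v_j$. The Smith normal form of an integer matrix $M$ is the unique diagonal matrix $\operatorname{diag}(d_1,\dots,d_n)$ with $d_i\ge0$, $d_i\mid d_{i+1}$, and $M=P\operatorname{diag}(d_1,\dots,d_n)Q$ for some $P,Q\in GL_n(\mathbb{Z})$. $\operatorname{Pic}(G)=\mathbb{Z}^n/L_G^T\mathbb{Z}^n$, $\mathbb{Z}_m=\mathbb{Z}/m\mathbb{Z}$. -}

module Defs where

open import Data.Nat as ℕ using (ℕ; zero; suc; _∸_)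
open import Data.Bool using (Bool; true; false; if_then_else_; _∨_; _∧_)
open import Data.Fin using (Fin; toℕ)
open import Data.Integer as ℤ using (ℤ; +_; _+_; _*_; -_; _-_; _≤_)
open import Data.Integer.Divisibility using (_∣_)
open import Data.Product using (Σ; ∃; _×_; _,_)
open import Relation.Binary.PropositionalEquality using (_≡_)
open import Relation.Nullary.Decidable using (⌊_⌋)

Vector : ℕ → Set
Vector n = Fin n → ℤ

Matrix : ℕ → Set
Matrix n = Fin n → Fin n → ℤ

sumFin : ∀ {n} → (Fin n → ℤ) → ℤ
sumFin {zero}  f = + 0
sumFin {suc n} f = f Data.Fin.zero + sumFin (λ i → f (Data.Fin.suc i))

sumFinℕ : ∀ {n} → (Fin n → ℕ) → ℕ
sumFinℕ {zero}  f = 0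
sumFinℕ {suc n} f = f Data.Fin.zero ℕ.+ sumFinℕ (λ i → f (Data.Fin.suc i))

_⊗_ : ∀ {n} → Matrix n → Matrix n → Matrix n
(A ⊗ B) i j = sumFin (λ k → A i k * B k j)

_≋_ : ∀ {n} → Matrix n → Matrix n → Set
A ≋ B = ∀ i j → A i j ≡ B i j

transpose : ∀ {n} → Matrix n → Matrix n
transpose A i j = A j i

_·_ : ∀ {n} → Matrix n → Vector n → Vector n
(A · x) i = sumFin (λ k → A i k * x k)

_≟F_ : ∀ {n} → Fin n → Fin n → Bool
i ≟F j = ⌊ i Data.Fin.≟ j ⌋

identity : ∀ {n} → Matrix n
identity i j = if i ≟F j then + 1 else + 0

diag : ∀ {n} → (Fin n → ℤ) → Matrix n
diag d i j = if i ≟F j then d i else + 0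

Invertible : ∀ {n} → Matrix n → Set
Invertible {n} P = Σ (Matrix n) λ P' → ((P ⊗ P') ≋ identity) × ((P' ⊗ P) ≋ identity)

IsSmithNormalForm : ∀ {n} → Matrix n → (Fin n → ℤ) → Set
IsSmithNormalForm {n} M d =
  (∀ i → + 0 ≤ d i) ×
  (∀ i j → toℕ j ≡ suc (toℕ i) → d i ∣ d j) ×
  Σ (Matrix n) λ P → Σ (Matrix n) λ Q →
    Invertible P × Invertible Q × (M ≋ ((P ⊗ diag d) ⊗ Q))

-- arrows i j = number of arrows from v_i to v_j
-- (a bi-directional arrow contributes one arrow each way)
Digraph : ℕ → Set
Digraph n = Fin n → Fin n → ℕ

outdeg : ∀ {n} → Digraph n → Fin n → ℕ
outdeg G i = sumFinℕ (λ j → G i j)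

laplacian : ∀ {n} → Digraph n → Matrix n
laplacian G i j = if i ≟F j then + (outdeg G i) else - (+ (G i j))

-- The directed wheel W''_n.  Vertex v_{k+1} is the element of Fin n with
-- toℕ = k; so toℕ 0 is the axle v_1 and toℕ 1 … n-1 are the rim v_2 … v_n.

_==_ : ℕ → ℕ → Bool
a == b = ⌊ a ℕ.≟ b ⌋

rimAdj : ℕ → ℕ → ℕ → Bool
rimAdj n a b = (b == suc a) ∨ (a == suc b) ∨ ((a == 1) ∧ (b == (n ∸ 1)))
                 ∨ ((b == 1) ∧ (a == (n ∸ 1)))

wheel'' : (n : ℕ) → Digraph n
wheel'' n i j with toℕ i | toℕ j
... | zero  | zero  = 0
... | zero  | suc _ = 1
... | suc _ | zero  = 0
... | suc a | suc b = if rimAdj n (suc a) (suc b) then 1 else 0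

-- Picard group Pic(G) = ℤ^n / L_Gᵀ ℤ^n, as a relation on ℤ^n

PicRel : ∀ {n} → Digraph n → Vector n → Vector n → Set
PicRel {n} G x y = Σ (Vector n) λ z → ∀ i → x i - y i ≡ (transpose (laplacian G) · z) i

-- ℤ_{e_1} × … × ℤ_{e_k} as ℤ^k modulo the relation x_i ≡ y_i (mod e_i);
-- a factor ℤ is represented by modulus 0 (0 ∣ t iff t = 0)
ModRel : ∀ {k} → (Fin k → ℤ) → (Fin k → ℤ) → (Fin k → ℤ) → Set
ModRel e x y = ∀ i → e i ∣ (x i - y i)

-- Pic(G) ≅ ℤ_{e_1} × … × ℤ_{e_k} as abelian groups: an additive map
-- ℤ^n → ℤ^k inducing a well-defined, injective, surjective map on quotients
PicIso : ∀ {n k} → Digraph n → (Fin k → ℤ) → Set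
PicIso {n} {k} G e =
  Σ (Vector n → (Fin k → ℤ)) λ φ →
    (∀ x y i → φ (λ j → x j + y j) i ≡ φ x i + φ y i) ×
    (∀ x y → PicRel G x y → ModRel e (φ x) (φ y)) ×
    (∀ x y → ModRel e (φ x) (φ y) → PicRel G x y) ×
    (∀ t → ∃ λ x → ModRel e (φ x) t)

-- the diagonal entries diag(1,…,1,a,b,0) with n-3 ones
snfEntries : (n : ℕ) → ℤ → ℤ → Fin n → ℤ
snfEntries n a b k =
  if suc (suc (suc (suc (toℕ k)))) ℕ.≤ᵇ n then + 1
  else if toℕ k == (n ∸ 3) then a
  else if toℕ k == (n ∸ 2) then b
  else + 0

triple : ℤ → ℤ → ℤ → Fin 3 → ℤ
triple x y z Data.Fin.zero = x
triple x y z (Data.Fin.suc Data.Fin.zero) = y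
triple x y z (Data.Fin.suc (Data.Fin.suc Data.Fin.zero)) = z

-- Write n = p + 3. The rows of L at the inner rim vertices v₃ … v_{n−1} are second
-- differences −e_{k−1} + 2e_k − e_{k+1}; taking them as the first p rows of Q makes Q
-- block triangular (they are triangular on the columns v₄ … v_n), the last three rows
-- being two rows qᵃ, qᵇ on the columns v₁ v₂ v₃ and the unit row at v₃. The rows of L
-- at v₁, v₂ and v_n are then combinations of the rows of Q with triangular-number
-- coefficients for v₁ and linear ones for v₂ and v_n (this is P), and what is left is
-- a 2 × 2 Smith problem on the columns v₁, v₂, solved separately for n even and odd.
-- P and Q come with explicit inverses, and L = P D Q identifies ℤⁿ / Lᵀℤⁿ with
-- ℤ × ℤ_a × ℤ_b through the coordinates Q'ᵀ x.

module Submission where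

open import Defs
open import Data.Bool using (Bool; true; false; if_then_else_; _∨_; _∧_)
open import Data.Empty using (⊥-elim)
open import Data.Fin as Fin using (Fin; toℕ)
open import Data.Fin.Patterns using (0F; 1F; 2F)
open import Data.Fin.Properties using (toℕ<n; toℕ-injective; toℕ-fromℕ<)
open import Data.Integer as ℤ using (ℤ; +_; _+_; _*_; -_; _-_)
import Data.Integer.Divisibility as ℤ∣
import Data.Integer.Divisibility.Signed as ℤ∣ˢ
import Data.Integer.Properties as ℤP
open import Data.Integer.Tactic.RingSolver using (solve-∀)
open import Data.Nat as ℕ using (ℕ; zero; suc; _∸_; _/_; _<_; _≤_; z≤n; s≤s; _≡ᵇ_; _<ᵇ_)
open import Data.Nat.Divisibility using (_∣_; divides)
import Data.Nat.Divisibility as ℕ∣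
open import Data.Nat.DivMod using (m*n/n≡m)
import Data.Nat.Properties as ℕP
import Data.Nat.Tactic.RingSolver as ℕRing
open import Data.Product using (∃; _×_; _,_)
open import Data.Sum using (_⊎_; inj₁; inj₂)
open import Function using (_∘_)
open import Relation.Binary.Definitions using (tri<; tri≈; tri>)
open import Relation.Binary.PropositionalEquality
open import Relation.Nullary using (¬_; yes; no)
open import Relation.Nullary.Decidable using (does; isYes≗does)

∑ : ℕ → (ℕ → ℤ) → ℤ
∑ zero    f = + 0
∑ (suc n) f = f 0 + ∑ n (λ k → f (suc k))

infix 5 ∑
syntax ∑ n (λ k → e) = ∑[ k < n ] e

∑-cong : ∀ n {f g : ℕ → ℤ} → (∀ k → k < n → f k ≡ g k) → ∑ n f ≡ ∑ n g
∑-cong zero    f≡g = refl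
∑-cong (suc n) f≡g = cong₂ _+_ (f≡g 0 (s≤s z≤n)) (∑-cong n (λ k k<n → f≡g (suc k) (s≤s k<n)))

∑-zero : ∀ n → ∑[ k < n ] + 0 ≡ + 0
∑-zero zero    = refl
∑-zero (suc n) = trans (ℤP.+-identityˡ _) (∑-zero n)

∑-+ : ∀ n (f g : ℕ → ℤ) → ∑[ k < n ] (f k + g k) ≡ ∑ n f + ∑ n g
∑-+ zero    f g = refl
∑-+ (suc n) f g = trans (cong (λ s → f 0 + g 0 + s) (∑-+ n _ _)) (interchange (f 0) (g 0) _ _)
  where
  interchange : ∀ a b c d → a + b + (c + d) ≡ a + c + (b + d)
  interchange = solve-∀

∑-*ˡ : ∀ n c (f : ℕ → ℤ) → ∑[ k < n ] (c * f k) ≡ c * ∑ n f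
∑-*ˡ zero    c f = sym (ℤP.*-zeroʳ c)
∑-*ˡ (suc n) c f = trans (cong (λ s → c * f 0 + s) (∑-*ˡ n c _)) (sym (ℤP.*-distribˡ-+ c (f 0) _))

∑-lin3 : ∀ n a b c (f g h : ℕ → ℤ) →
  ∑[ k < n ] (a * f k + b * g k + c * h k) ≡ a * ∑ n f + b * ∑ n g + c * ∑ n h
∑-lin3 n a b c f g h =
  trans (∑-+ n (λ k → a * f k + b * g k) (λ k → c * h k))
        (cong₂ _+_ (trans (∑-+ n (λ k → a * f k) (λ k → b * g k)) (cong₂ _+_ (∑-*ˡ n a f) (∑-*ˡ n b g)))
                   (∑-*ˡ n c h))

∑-last : ∀ n (f : ℕ → ℤ) → ∑ (suc n) f ≡ ∑ n f + f n
∑-last zero    f = ℤP.+-comm (f 0) (+ 0)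
∑-last (suc n) f = trans (cong (λ s → f 0 + s) (∑-last n _)) (sym (ℤP.+-assoc (f 0) _ _))

==≡≡ᵇ : ∀ a b → (a == b) ≡ (a ≡ᵇ b)
==≡≡ᵇ a b = isYes≗does (a ℕ.≟ b)

≡ᵇ-refl : ∀ a → (a ≡ᵇ a) ≡ true
≡ᵇ-refl zero    = refl
≡ᵇ-refl (suc a) = ≡ᵇ-refl a

≡ᵇ-≢ : ∀ {a b} → a ≢ b → (a ≡ᵇ b) ≡ false
≡ᵇ-≢ {zero}  {zero}  a≢b = ⊥-elim (a≢b refl)
≡ᵇ-≢ {zero}  {suc b} a≢b = refl
≡ᵇ-≢ {suc a} {zero}  a≢b = refl
≡ᵇ-≢ {suc a} {suc b} a≢b = ≡ᵇ-≢ (a≢b ∘ cong suc)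

≡ᵇ-sym : ∀ a b → (a ≡ᵇ b) ≡ (b ≡ᵇ a)
≡ᵇ-sym zero    zero    = refl
≡ᵇ-sym zero    (suc b) = refl
≡ᵇ-sym (suc a) zero    = refl
≡ᵇ-sym (suc a) (suc b) = ≡ᵇ-sym a b

<ᵇ-true : ∀ {a b} → a < b → (a <ᵇ b) ≡ true
<ᵇ-true {zero}  {suc b} _         = refl
<ᵇ-true {suc a} {suc b} (s≤s a<b) = <ᵇ-true a<b

<ᵇ-false : ∀ {a b} → b ≤ a → (a <ᵇ b) ≡ false
<ᵇ-false {a}     {zero}  _         = refl
<ᵇ-false {suc a} {suc b} (s≤s b≤a) = <ᵇ-false b≤a

δ : ℕ → ℕ → ℤ
δ a b = if a ≡ᵇ b then + 1 else + 0

δ-refl : ∀ a → δ a a ≡ + 1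
δ-refl a rewrite ≡ᵇ-refl a = refl

δ-sym : ∀ a b → δ a b ≡ δ b a
δ-sym a b rewrite ≡ᵇ-sym a b = refl

δ-≢ : ∀ {a b} → a ≢ b → δ a b ≡ + 0
δ-≢ a≢b rewrite ≡ᵇ-≢ a≢b = refl

δ-< : ∀ {a b} → a < b → δ a b ≡ + 0
δ-< a<b = δ-≢ (ℕP.<⇒≢ a<b)

δ-> : ∀ {a b} → b < a → δ a b ≡ + 0
δ-> b<a = δ-≢ (ℕP.>⇒≢ b<a)

∑-δ : ∀ n q (f : ℕ → ℤ) → q < n → ∑[ k < n ] (δ q k * f k) ≡ f q
∑-δ (suc n) zero    f _ =
  trans (cong₂ _+_ (ℤP.*-identityˡ (f 0)) (trans (∑-cong n (λ k _ → ℤP.*-zeroˡ (f (suc k)))) (∑-zero n)))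
        (ℤP.+-identityʳ (f 0))
∑-δ (suc n) (suc q) f (s≤s q<n) =
  trans (cong₂ _+_ (ℤP.*-zeroˡ (f 0)) (∑-δ n q (λ k → f (suc k)) q<n)) (ℤP.+-identityˡ (f (suc q)))

∑-*-zero : ∀ n (f : ℕ → ℤ) → ∑[ k < n ] (f k * + 0) ≡ + 0
∑-*-zero n f = trans (∑-cong n (λ k _ → ℤP.*-zeroʳ (f k))) (∑-zero n)

sumFin≡∑ : ∀ n (f : ℕ → ℤ) → sumFin {n} (f ∘ toℕ) ≡ ∑ n f
sumFin≡∑ zero    f = refl
sumFin≡∑ (suc n) f = cong (λ s → f 0 + s) (sumFin≡∑ n (f ∘ suc))

sumFinℕ≡∑ : ∀ n (f : ℕ → ℕ) → + sumFinℕ {n} (f ∘ toℕ) ≡ ∑[ k < n ] + f k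
sumFinℕ≡∑ zero    f = refl
sumFinℕ≡∑ (suc n) f = cong (λ s → + f 0 + s) (sumFinℕ≡∑ n (f ∘ suc))

sumFinℕ-cong : ∀ {n} {f g : Fin n → ℕ} → (∀ k → f k ≡ g k) → sumFinℕ f ≡ sumFinℕ g
sumFinℕ-cong {zero}  f≗g = refl
sumFinℕ-cong {suc n} f≗g = cong₂ ℕ._+_ (f≗g Fin.zero) (sumFinℕ-cong (f≗g ∘ Fin.suc))

≟F≡≡ᵇ : ∀ {n} (i j : Fin n) → (i ≟F j) ≡ (toℕ i ≡ᵇ toℕ j)
≟F≡≡ᵇ i j = trans (isYes≗does (i Fin.≟ j)) (does-≟ i j)
  where
  does-≟ : ∀ {n} (i j : Fin n) → does (i Fin.≟ j) ≡ (toℕ i ≡ᵇ toℕ j)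
  does-≟ Fin.zero    Fin.zero    = refl
  does-≟ Fin.zero    (Fin.suc j) = refl
  does-≟ (Fin.suc i) Fin.zero    = refl
  does-≟ (Fin.suc i) (Fin.suc j) = does-≟ i j

identity≡δ : ∀ {n} (i j : Fin n) → identity i j ≡ δ (toℕ i) (toℕ j)
identity≡δ i j rewrite ≟F≡≡ᵇ i j = refl

identity-sym : ∀ {n} (i j : Fin n) → identity i j ≡ identity j i
identity-sym i j = trans (identity≡δ i j) (trans (δ-sym (toℕ i) (toℕ j)) (sym (identity≡δ j i)))

sumFin-cong : ∀ {n} {f g : Vector n} → (∀ k → f k ≡ g k) → sumFin f ≡ sumFin g
sumFin-cong {zero}  f≗g = refl
sumFin-cong {suc n} f≗g = cong₂ _+_ (f≗g Fin.zero) (sumFin-cong (f≗g ∘ Fin.suc))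

sumFin-zero : ∀ n → sumFin {n} (λ _ → + 0) ≡ + 0
sumFin-zero zero    = refl
sumFin-zero (suc n) = trans (ℤP.+-identityˡ _) (sumFin-zero n)

sumFin-+ : ∀ {n} (f g : Vector n) → sumFin (λ k → f k + g k) ≡ sumFin f + sumFin g
sumFin-+ {zero}  f g = refl
sumFin-+ {suc n} f g =
  trans (cong (λ s → f Fin.zero + g Fin.zero + s) (sumFin-+ (f ∘ Fin.suc) (g ∘ Fin.suc)))
        (interchange (f Fin.zero) (g Fin.zero) _ _)
  where
  interchange : ∀ a b c d → a + b + (c + d) ≡ a + c + (b + d)
  interchange = solve-∀

sumFin-*ˡ : ∀ {n} c (f : Vector n) → sumFin (λ k → c * f k) ≡ c * sumFin f
sumFin-*ˡ {zero}  c f = sym (ℤP.*-zeroʳ c)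
sumFin-*ˡ {suc n} c f =
  trans (cong (λ s → c * f Fin.zero + s) (sumFin-*ˡ c (f ∘ Fin.suc))) (sym (ℤP.*-distribˡ-+ c _ _))

sumFin-comm : ∀ {m n} (f : Fin m → Fin n → ℤ) →
              sumFin (λ i → sumFin (λ j → f i j)) ≡ sumFin (λ j → sumFin (λ i → f i j))
sumFin-comm {zero}  {n} f = sym (sumFin-zero n)
sumFin-comm {suc m} {n} f =
  trans (cong (λ s → sumFin (f Fin.zero) + s) (sumFin-comm (f ∘ Fin.suc)))
        (sym (sumFin-+ (f Fin.zero) (λ j → sumFin (λ i → f (Fin.suc i) j))))

identity-· : ∀ {n} (v : Vector n) i → (identity · v) i ≡ v i
identity-· {suc n} v Fin.zero =
  trans (cong₂ _+_ (ℤP.*-identityˡ (v Fin.zero))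
          (trans (sumFin-cong (λ k → ℤP.*-zeroˡ (v (Fin.suc k)))) (sumFin-zero n)))
        (ℤP.+-identityʳ (v Fin.zero))
identity-· {suc n} v (Fin.suc i) =
  trans (cong₂ _+_ (ℤP.*-zeroˡ (v Fin.zero))
          (trans (sumFin-cong (λ k → cong (_* v (Fin.suc k)) (identity-suc k))) (identity-· (v ∘ Fin.suc) i)))
        (ℤP.+-identityˡ (v (Fin.suc i)))
  where
  identity-suc : ∀ k → identity (Fin.suc i) (Fin.suc k) ≡ identity i k
  identity-suc k = trans (identity≡δ (Fin.suc i) (Fin.suc k)) (sym (identity≡δ i k))

module _ {n : ℕ} where

  ·-congˡ : {A B : Matrix n} → A ≋ B → ∀ v i → (A · v) i ≡ (B · v) i
  ·-congˡ A≋B v i = sumFin-cong (λ k → cong (_* v k) (A≋B i k))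

  ·-congʳ : (A : Matrix n) {v w : Vector n} → (∀ k → v k ≡ w k) → ∀ i → (A · v) i ≡ (A · w) i
  ·-congʳ A v≗w i = sumFin-cong (λ k → cong (A i k *_) (v≗w k))

  ·-⊗ : (A B : Matrix n) (v : Vector n) → ∀ i → (A · (B · v)) i ≡ ((A ⊗ B) · v) i
  ·-⊗ A B v i = begin
    ∑ᶠ (λ k → A i k * ∑ᶠ (λ l → B k l * v l))   ≡⟨ sumFin-cong (λ k → sym (sumFin-*ˡ (A i k) (λ l → B k l * v l))) ⟩
    ∑ᶠ (λ k → ∑ᶠ (λ l → A i k * (B k l * v l))) ≡⟨ sumFin-comm (λ k l → A i k * (B k l * v l)) ⟩
    ∑ᶠ (λ l → ∑ᶠ (λ k → A i k * (B k l * v l))) ≡⟨ sumFin-cong (λ l → sumFin-cong (λ k →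
                                                     sym (ℤP.*-assoc (A i k) (B k l) (v l)))) ⟩
    ∑ᶠ (λ l → ∑ᶠ (λ k → A i k * B k l * v l))   ≡⟨ sumFin-cong pull-out ⟩
    ∑ᶠ (λ l → (A ⊗ B) i l * v l)                 ∎
    where
    open ≡-Reasoning
    ∑ᶠ : Vector n → ℤ
    ∑ᶠ = sumFin
    pull-out : ∀ l → ∑ᶠ (λ k → A i k * B k l * v l) ≡ (A ⊗ B) i l * v l
    pull-out l = trans (sumFin-cong (λ k → ℤP.*-comm (A i k * B k l) (v l)))
                       (trans (sumFin-*ˡ (v l) (λ k → A i k * B k l)) (ℤP.*-comm (v l) _))

  ·-- : (A : Matrix n) (v w : Vector n) → ∀ i → (A · (λ k → v k - w k)) i ≡ (A · v) i - (A · w) i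
  ·-- A v w i =
    trans (sumFin-cong (λ k → expand (A i k) (v k) (w k)))
    (trans (sumFin-+ (λ k → A i k * v k) (λ k → - + 1 * (A i k * w k)))
    (cong (λ s → (A · v) i + s) (trans (sumFin-*ˡ (- + 1) (λ k → A i k * w k)) (ℤP.-1*i≡-i ((A · w) i)))))
    where
    expand : ∀ a x y → a * (x - y) ≡ a * x + - + 1 * (a * y)
    expand = solve-∀

  transpose-⊗ : (A B : Matrix n) → transpose (A ⊗ B) ≋ (transpose B ⊗ transpose A)
  transpose-⊗ A B i j = sumFin-cong (λ k → ℤP.*-comm (A j k) (B k i))

  transpose-diag-· : (d : Vector n) (v : Vector n) → ∀ i → (transpose (diag d) · v) i ≡ d i * v i
  transpose-diag-· d v i =
    trans (sumFin-cong (λ k → trans (cong (_* v k) (diag-as-identity k)) (ℤP.*-assoc (identity i k) (d k) (v k))))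
          (identity-· (λ k → d k * v k) i)
    where
    diag-as-identity : ∀ k → diag d k i ≡ identity i k * d k
    diag-as-identity k with k Fin.≟ i | i Fin.≟ k
    ... | yes refl | yes _   = sym (ℤP.*-identityˡ (d k))
    ... | no _     | no _    = refl
    ... | yes k≡i  | no i≢k  = ⊥-elim (i≢k (sym k≡i))
    ... | no k≢i   | yes i≡k = ⊥-elim (k≢i (sym i≡k))

  transpose-inverse-· : (A A' : Matrix n) → (A ⊗ A') ≋ identity →
                        ∀ v i → (transpose A' · (transpose A · v)) i ≡ v i
  transpose-inverse-· A A' AA'≋I v i = begin
    (transpose A' · (transpose A · v)) i   ≡⟨ ·-⊗ (transpose A') (transpose A) v i ⟩
    ((transpose A' ⊗ transpose A) · v) i   ≡⟨ ·-congˡ (λ r s → sym (transpose-⊗ A A' r s)) v i ⟩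
    (transpose (A ⊗ A') · v) i             ≡⟨ ·-congˡ (λ r s → trans (AA'≋I s r) (identity-sym s r)) v i ⟩
    (identity · v) i                       ≡⟨ identity-· v i ⟩
    v i                                    ∎
    where open ≡-Reasoning

toMatrix : ∀ n → (ℕ → ℕ → ℤ) → Matrix n
toMatrix n A i j = A (toℕ i) (toℕ j)

toMatrix-inverse : ∀ n (A B : ℕ → ℕ → ℤ) →
  (∀ i j → i < n → j < n → ∑[ k < n ] (A i k * B k j) ≡ δ i j) →
  (toMatrix n A ⊗ toMatrix n B) ≋ identity
toMatrix-inverse n A B AB≡δ i j =
  trans (sumFin≡∑ n (λ k → A (toℕ i) k * B k (toℕ j)))
        (trans (AB≡δ _ _ (toℕ<n i) (toℕ<n j)) (sym (identity≡δ i j)))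

toMatrix-⊗-diag : ∀ n (P Q : ℕ → ℕ → ℤ) (D : ℕ → ℤ) (d : Vector n) → (∀ k → d k ≡ D (toℕ k)) →
  ∀ i j → ((toMatrix n P ⊗ diag d) ⊗ toMatrix n Q) i j ≡ ∑[ k < n ] (P (toℕ i) k * D k * Q k (toℕ j))
toMatrix-⊗-diag n P Q D d d≡D i j =
  trans (sumFin-cong (λ k → cong (_* Q (toℕ k) (toℕ j)) (PD≡ k)))
        (sumFin≡∑ n (λ k → P (toℕ i) k * D k * Q k (toℕ j)))
  where
  diag≡δ : ∀ k' k → diag d k' k ≡ δ (toℕ k) (toℕ k') * D (toℕ k')
  diag≡δ k' k rewrite ≟F≡≡ᵇ k' k | d≡D k' | δ-sym (toℕ k) (toℕ k') with toℕ k' ≡ᵇ toℕ k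
  ... | true  = sym (ℤP.*-identityˡ _)
  ... | false = sym (ℤP.*-zeroˡ (D (toℕ k')))
  PD≡ : ∀ k → (toMatrix n P ⊗ diag d) i k ≡ P (toℕ i) (toℕ k) * D (toℕ k)
  PD≡ k = begin
    sumFin {n} (λ k' → P (toℕ i) (toℕ k') * diag d k' k)
      ≡⟨ sumFin-cong (λ k' → cong (P (toℕ i) (toℕ k') *_) (diag≡δ k' k)) ⟩
    sumFin {n} (λ k' → P (toℕ i) (toℕ k') * (δ (toℕ k) (toℕ k') * D (toℕ k')))
      ≡⟨ sumFin≡∑ n (λ k' → P (toℕ i) k' * (δ (toℕ k) k' * D k')) ⟩
    ∑[ k' < n ] (P (toℕ i) k' * (δ (toℕ k) k' * D k'))
      ≡⟨ ∑-cong n (λ k' _ → reorder (P (toℕ i) k') (δ (toℕ k) k') (D k')) ⟩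
    ∑[ k' < n ] (δ (toℕ k) k' * (P (toℕ i) k' * D k'))
      ≡⟨ ∑-δ n (toℕ k) (λ k' → P (toℕ i) k' * D k') (toℕ<n k) ⟩
    P (toℕ i) (toℕ k) * D (toℕ k)
      ∎
    where
    open ≡-Reasoning
    reorder : ∀ a b c → a * (b * c) ≡ b * (a * c)
    reorder = solve-∀

transpose-smith-· : ∀ {n} (M P Q : Matrix n) (d : Vector n) → M ≋ ((P ⊗ diag d) ⊗ Q) →
  ∀ z i → (transpose M · z) i ≡ (transpose Q · (λ r → d r * (transpose P · z) r)) i
transpose-smith-· {n} M P Q d M≋PDQ z i = begin
  (transpose M · z) i                                    ≡⟨ ·-congˡ (λ r s → M≋PDQ s r) z i ⟩
  (transpose ((P ⊗ diag d) ⊗ Q) · z) i                   ≡⟨ ·-congˡ (transpose-⊗ (P ⊗ diag d) Q) z i ⟩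
  ((transpose Q ⊗ transpose (P ⊗ diag d)) · z) i         ≡⟨ sym (·-⊗ (transpose Q) _ z i) ⟩
  (transpose Q · (transpose (P ⊗ diag d) · z)) i         ≡⟨ ·-congʳ (transpose Q) scale i ⟩
  (transpose Q · (λ r → d r * (transpose P · z) r)) i    ∎
  where
  open ≡-Reasoning
  scale : ∀ r → (transpose (P ⊗ diag d) · z) r ≡ d r * (transpose P · z) r
  scale r = begin
    (transpose (P ⊗ diag d) · z) r                 ≡⟨ ·-congˡ (transpose-⊗ P (diag d)) z r ⟩
    ((transpose (diag d) ⊗ transpose P) · z) r     ≡⟨ sym (·-⊗ (transpose (diag d)) (transpose P) z r) ⟩
    (transpose (diag d) · (transpose P · z)) r     ≡⟨ transpose-diag-· d (transpose P · z) r ⟩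
    d r * (transpose P · z) r                      ∎

-- Pic(G) is read off in the coordinates Q'ᵀ x at the positions σ of the non-unit diagonal entries.
smith⇒picIso : ∀ {n k} (G : Digraph n) (P P' Q Q' : Matrix n) (d : Vector n) →
  (P' ⊗ P) ≋ identity → (Q ⊗ Q') ≋ identity → (Q' ⊗ Q) ≋ identity →
  laplacian G ≋ ((P ⊗ diag d) ⊗ Q) →
  (σ : Fin k → Fin n) → (∀ {i i'} → σ i ≡ σ i' → i ≡ i') →
  (e : Fin k → ℤ) → (∀ i → d (σ i) ≡ e i) →
  (∀ r → (∃ λ i → σ i ≡ r) ⊎ d r ≡ + 1) →
  PicIso G e
smith⇒picIso {n} {k} G P P' Q Q' d P'P≋I QQ'≋I Q'Q≋I L≋PDQ σ σ-injective e dσ≡e units =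
  φ , φ-+ , rel⇒mod , mod⇒rel , surjective
  where
  φ : Vector n → Fin k → ℤ
  φ x i = (transpose Q' · x) (σ i)

  φ-+ : ∀ x y i → φ (λ j → x j + y j) i ≡ φ x i + φ y i
  φ-+ x y i = trans (sumFin-cong (λ r → ℤP.*-distribˡ-+ (Q' r (σ i)) (x r) (y r)))
                    (sumFin-+ (λ r → Q' r (σ i) * x r) (λ r → Q' r (σ i) * y r))

  Q'ᵀLᵀ : ∀ z r → (transpose Q' · (transpose (laplacian G) · z)) r ≡ d r * (transpose P · z) r
  Q'ᵀLᵀ z r = trans (·-congʳ (transpose Q') (transpose-smith-· (laplacian G) P Q d L≋PDQ z) r)
                    (transpose-inverse-· Q Q' QQ'≋I (λ s → d s * (transpose P · z) s) r)

  rel⇒mod : ∀ x y → PicRel G x y → ModRel e (φ x) (φ y)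
  rel⇒mod x y (z , x-y≡Lᵀz) i = ℤ∣ˢ.∣⇒∣ᵤ (ℤ∣ˢ.divides ((transpose P · z) (σ i)) (begin
    φ x i - φ y i                                      ≡⟨ sym (·-- (transpose Q') x y (σ i)) ⟩
    (transpose Q' · (λ r → x r - y r)) (σ i)           ≡⟨ ·-congʳ (transpose Q') x-y≡Lᵀz (σ i) ⟩
    (transpose Q' · (transpose (laplacian G) · z)) (σ i) ≡⟨ Q'ᵀLᵀ z (σ i) ⟩
    d (σ i) * (transpose P · z) (σ i)                  ≡⟨ cong (_* (transpose P · z) (σ i)) (dσ≡e i) ⟩
    e i * (transpose P · z) (σ i)                      ≡⟨ ℤP.*-comm (e i) _ ⟩
    (transpose P · z) (σ i) * e i                      ∎))
    where open ≡-Reasoning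

  mod⇒rel : ∀ x y → ModRel e (φ x) (φ y) → PicRel G x y
  mod⇒rel x y φx≡φy = z , λ i → sym (begin
    (transpose (laplacian G) · z) i                  ≡⟨ transpose-smith-· (laplacian G) P Q d L≋PDQ z i ⟩
    (transpose Q · (λ r → d r * (transpose P · z) r)) i ≡⟨ ·-congʳ (transpose Q) d*c≡v i ⟩
    (transpose Q · v) i                              ≡⟨ transpose-inverse-· Q' Q Q'Q≋I w i ⟩
    x i - y i                                        ∎)
    where
    open ≡-Reasoning
    w v : Vector n
    w r = x r - y r
    v = transpose Q' · w
    d∣v : ∀ r → d r ℤ∣ˢ.∣ v r
    d∣v r with units r
    ... | inj₁ (i , refl) =
      ℤ∣ˢ.∣ᵤ⇒∣ (subst₂ ℤ∣._∣_ (sym (dσ≡e i)) (sym (·-- (transpose Q') x y (σ i))) (φx≡φy i))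
    ... | inj₂ dr≡1       = ℤ∣ˢ.∣ᵤ⇒∣ (subst (ℤ∣._∣ v r) (sym dr≡1) (ℕ∣.1∣ _))
    c z : Vector n
    c r = ℤ∣ˢ.quotient (d∣v r)
    z = transpose P' · c
    d*c≡v : ∀ r → d r * (transpose P · z) r ≡ v r
    d*c≡v r = begin
      d r * (transpose P · z) r ≡⟨ cong (d r *_) (transpose-inverse-· P' P P'P≋I c r) ⟩
      d r * c r                 ≡⟨ ℤP.*-comm (d r) (c r) ⟩
      c r * d r                 ≡⟨ sym (ℤ∣ˢ._∣_.equality (d∣v r)) ⟩
      v r                       ∎

  lift-at : (Fin k → ℤ) → ∀ r → (∃ λ i → σ i ≡ r) ⊎ d r ≡ + 1 → ℤ
  lift-at t r (inj₁ (i , _)) = t i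
  lift-at t r (inj₂ _)       = + 0

  lift-at-σ : ∀ t i unit? → e i ℤ∣.∣ (lift-at t (σ i) unit? - t i)
  lift-at-σ t i (inj₁ (i' , σi'≡σi)) rewrite σ-injective σi'≡σi | ℤP.+-inverseʳ (t i) = ℕ∣._∣0 _
  lift-at-σ t i (inj₂ dσi≡1) =
    subst (ℤ∣._∣ (lift-at t (σ i) (inj₂ dσi≡1) - t i)) (trans (sym dσi≡1) (dσ≡e i)) (ℕ∣.1∣ _)

  surjective : ∀ t → ∃ λ x → ModRel e (φ x) t
  surjective t = x , λ i → subst (λ s → e i ℤ∣.∣ (s - t i))
                                 (sym (transpose-inverse-· Q Q' QQ'≋I lift (σ i)))
                                 (lift-at-σ t i (units (σ i)))
    where
    lift x : Vector n
    lift r = lift-at t r (units r)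
    x = transpose Q · lift

prefixThen : ℕ → (ℕ → ℤ) → (ℕ → ℤ) → ℕ → ℤ
prefixThen zero    f g k       = g k
prefixThen (suc p) f g zero    = f 0
prefixThen (suc p) f g (suc k) = prefixThen p (λ r → f (suc r)) g k

prefixThen-< : ∀ p f g {k} → k < p → prefixThen p f g k ≡ f k
prefixThen-< (suc p) f g {zero}  _         = refl
prefixThen-< (suc p) f g {suc k} (s≤s k<p) = prefixThen-< p (λ r → f (suc r)) g k<p

prefixThen-+ : ∀ p f g k → prefixThen p f g (k ℕ.+ p) ≡ g k
prefixThen-+ zero    f g k = cong g (ℕP.+-identityʳ k)
prefixThen-+ (suc p) f g k rewrite ℕP.+-suc k p = prefixThen-+ p (λ r → f (suc r)) g k

prefixThen-≥ : ∀ p f c {k} → p ≤ k → prefixThen p f (λ _ → c) k ≡ c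
prefixThen-≥ zero    f c _                 = refl
prefixThen-≥ (suc p) f c {suc k} (s≤s p≤k) = prefixThen-≥ p (λ r → f (suc r)) c p≤k

∑-*-δ≡prefixThen : ∀ p (g : ℕ → ℤ) t → ∑[ r < p ] (g r * δ r t) ≡ prefixThen p g (λ _ → + 0) t
∑-*-δ≡prefixThen zero    g t       = refl
∑-*-δ≡prefixThen (suc p) g zero    =
  trans (cong₂ _+_ (ℤP.*-identityʳ (g 0)) (∑-*-zero p (λ r → g (suc r)))) (ℤP.+-identityʳ (g 0))
∑-*-δ≡prefixThen (suc p) g (suc t) =
  trans (cong₂ _+_ (ℤP.*-zeroʳ (g 0)) (∑-*-δ≡prefixThen p (λ r → g (suc r)) t)) (ℤP.+-identityˡ _)

slots : ℤ → ℤ → ℤ → ℕ → ℤ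
slots x y z 0 = x
slots x y z 1 = y
slots x y z (suc (suc _)) = z

-- The Laplacian row of the rim vertex v_{r+3}, whose neighbours are v_{r+2} and v_{r+4}.
innerRow : ℕ → ℕ → ℤ
innerRow r j = + 2 * δ (suc (suc r)) j - δ (suc r) j - δ (suc (suc (suc r))) j

Δ² : (ℕ → ℤ) → ℕ → ℤ
Δ² g 0                     = + 0
Δ² g 1                     = - g 0
Δ² g 2                     = + 2 * g 0 - g 1
Δ² g (suc (suc (suc s)))   = + 2 * g (suc s) - g (suc (suc s)) - g s

∑-*-innerRow : ∀ p g j → ∑[ r < p ] (g r * innerRow r j) ≡ Δ² (prefixThen p g (λ _ → + 0)) j
∑-*-innerRow p g j =
  trans (∑-cong p (λ r _ → distribute (g r) (δ (suc (suc r)) j) (δ (suc r) j) (δ (suc (suc (suc r))) j)))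
  (trans (∑-lin3 p (+ 2) (- + 1) (- + 1) (λ r → g r * δ (suc (suc r)) j) (λ r → g r * δ (suc r) j)
                 (λ r → g r * δ (suc (suc (suc r))) j))
         (evaluate j))
  where
  distribute : ∀ g x y z → g * (+ 2 * x - y - z) ≡ + 2 * (g * x) + - + 1 * (g * y) + - + 1 * (g * z)
  distribute = solve-∀
  ĝ : ℕ → ℤ
  ĝ = prefixThen p g (λ _ → + 0)
  sift : ∀ t → ∑[ r < p ] (g r * δ r t) ≡ ĝ t
  sift = ∑-*-δ≡prefixThen p g
  none : ∑[ r < p ] (g r * + 0) ≡ + 0
  none = ∑-*-zero p g
  combine : ∀ {x x' y y' z z'} → x ≡ x' → y ≡ y' → z ≡ z' →
            + 2 * x + - + 1 * y + - + 1 * z ≡ + 2 * x' + - + 1 * y' + - + 1 * z'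
  combine x≡ y≡ z≡ = cong₂ _+_ (cong₂ _+_ (cong (+ 2 *_) x≡) (cong (- + 1 *_) y≡)) (cong (- + 1 *_) z≡)
  evaluate : ∀ j → + 2 * (∑[ r < p ] (g r * δ (suc (suc r)) j)) + - + 1 * (∑[ r < p ] (g r * δ (suc r) j))
                   + - + 1 * (∑[ r < p ] (g r * δ (suc (suc (suc r))) j)) ≡ Δ² ĝ j
  evaluate 0 = combine none none none
  evaluate 1 = trans (combine none (sift 0) none) (ring (ĝ 0))
    where ring : ∀ x → + 2 * + 0 + - + 1 * x + - + 1 * + 0 ≡ - x
          ring = solve-∀
  evaluate 2 = trans (combine (sift 0) (sift 1) none) (ring (ĝ 0) (ĝ 1))
    where ring : ∀ x y → + 2 * x + - + 1 * y + - + 1 * + 0 ≡ + 2 * x - y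
          ring = solve-∀
  evaluate (suc (suc (suc s))) =
    trans (combine (sift (suc s)) (sift (suc (suc s))) (sift s)) (ring (ĝ (suc s)) (ĝ (suc (suc s))) (ĝ s))
    where ring : ∀ x y z → + 2 * x + - + 1 * y + - + 1 * z ≡ + 2 * x - y - z
          ring = solve-∀

Δ²-cong : ∀ {g h : ℕ → ℤ} → (∀ t → g t ≡ h t) → ∀ j → Δ² g j ≡ Δ² h j
Δ²-cong g≗h 0                   = refl
Δ²-cong g≗h 1                   = cong -_ (g≗h 0)
Δ²-cong g≗h 2                   = cong₂ _-_ (cong (+ 2 *_) (g≗h 0)) (g≗h 1)
Δ²-cong g≗h (suc (suc (suc s))) = cong₂ _-_ (cong₂ _-_ (cong (+ 2 *_) (g≗h (suc s))) (g≗h (suc (suc s)))) (g≗h s)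

∑-*-innerRow-vanishing : ∀ p g → (∀ r → p ≤ r → g r ≡ + 0) → ∀ j → ∑[ r < p ] (g r * innerRow r j) ≡ Δ² g j
∑-*-innerRow-vanishing p g g≥p≡0 j = trans (∑-*-innerRow p g j) (Δ²-cong prefix≗g j)
  where
  prefix≗g : ∀ t → prefixThen p g (λ _ → + 0) t ≡ g t
  prefix≗g t with ℕP.<-≤-connex t p
  ... | inj₁ t<p = prefixThen-< p g (λ _ → + 0) t<p
  ... | inj₂ p≤t = trans (prefixThen-≥ p g (+ 0) p≤t) (sym (g≥p≡0 t p≤t))

-- The second difference of the ramp t ↦ max(r − t, 0) is a unit impulse.
ramp-Δ² : ∀ r s → + 2 * - + (r ∸ s) - - + (r ∸ suc s) - - + (suc r ∸ s) ≡ δ r s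
ramp-Δ² zero    zero    = refl
ramp-Δ² zero    (suc s) rewrite ℕP.0∸n≡0 s = refl
ramp-Δ² (suc r) zero    = ring (+ r)
  where ring : ∀ a → + 2 * - (+ 1 + a) - - a - - (+ 1 + (+ 1 + a)) ≡ + 0
        ring = solve-∀
ramp-Δ² (suc r) (suc s) = ramp-Δ² r s

∑-innerRow-* : ∀ n r (f : ℕ → ℤ) → suc (suc (suc r)) < n →
  ∑[ v < n ] (innerRow r v * f v) ≡ + 2 * f (suc (suc r)) - f (suc r) - f (suc (suc (suc r)))
∑-innerRow-* n r f 3+r<n =
  trans (∑-cong n (λ v _ → distribute (δ (suc (suc r)) v) (δ (suc r) v) (δ (suc (suc (suc r))) v) (f v)))
  (trans (∑-lin3 n (+ 2) (- + 1) (- + 1) _ _ _)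
  (trans (cong₂ _+_ (cong₂ _+_ (cong (+ 2 *_) (∑-δ n (suc (suc r)) f (ℕP.<-trans (ℕP.n<1+n _) 3+r<n)))
                               (cong (- + 1 *_) (∑-δ n (suc r) f (ℕP.<-trans (ℕP.n<1+n _) (ℕP.<-trans (ℕP.n<1+n _) 3+r<n)))))
                    (cong (- + 1 *_) (∑-δ n (suc (suc (suc r))) f 3+r<n)))
         (ring (f (suc (suc r))) (f (suc r)) (f (suc (suc (suc r)))))))
  where
  distribute : ∀ x y z t → (+ 2 * x - y - z) * t ≡ + 2 * (x * t) + - + 1 * (y * t) + - + 1 * (z * t)
  distribute = solve-∀
  ring : ∀ x y z → + 2 * x + - + 1 * y + - + 1 * z ≡ + 2 * x - y - z
  ring = solve-∀

∑-δ₀₁₂-* : ∀ n a b c (f : ℕ → ℤ) → 3 ≤ n →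
  ∑[ v < n ] ((a * δ 0 v + b * δ 1 v + c * δ 2 v) * f v) ≡ a * f 0 + b * f 1 + c * f 2
∑-δ₀₁₂-* n a b c f 3≤n =
  trans (∑-cong n (λ v _ → distribute a b c (δ 0 v) (δ 1 v) (δ 2 v) (f v)))
  (trans (∑-lin3 n a b c _ _ _)
         (cong₂ _+_ (cong₂ _+_ (cong (a *_) (∑-δ n 0 f (ℕP.<-≤-trans (s≤s z≤n) 3≤n)))
                               (cong (b *_) (∑-δ n 1 f (ℕP.<-≤-trans (s≤s (s≤s z≤n)) 3≤n))))
                    (cong (c *_) (∑-δ n 2 f 3≤n))))
  where
  distribute : ∀ a b c x y z t → (a * x + b * y + c * z) * t ≡ a * (x * t) + b * (y * t) + c * (z * t)
  distribute = solve-∀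

∸≡suc∸suc : ∀ {m n} → n < m → m ∸ n ≡ suc (m ∸ suc n)
∸≡suc∸suc = ℕP.+-∸-assoc 1

triangle : ℕ → ℤ
triangle zero    = + 0
triangle (suc k) = + suc k + triangle k

triangle-pred : ∀ p → triangle p ≡ + p + triangle (p ∸ 1)
triangle-pred zero    = refl
triangle-pred (suc p) = refl

triangle-Δ² : ∀ p s → s < p → + 2 * triangle (p ∸ suc s) - triangle (p ∸ suc (suc s)) - triangle (p ∸ s) ≡ - + 1
triangle-Δ² (suc zero)    zero    _         = refl
triangle-Δ² (suc (suc p)) zero    _         = ring (+ p) (triangle p)
  where ring : ∀ a t → + 2 * (+ 1 + a + t) - t - (+ 1 + (+ 1 + a) + (+ 1 + a + t)) ≡ - + 1
        ring = solve-∀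
triangle-Δ² (suc p)       (suc s) (s≤s s<p) = triangle-Δ² p s s<p

-- The part of the reduction that depends on the parity of n. The rows qᵃ, qᵇ of Q
-- are supported on the columns v₁ v₂ v₃ with zero row sum; A = (α β)ᵀ is their block
-- on v₁ v₂ and (x y)ᵀ its inverse. D = diag(1, …, 1, a, b, 0) and u = P(v₂, a). The
-- equations a*α₀ … ua*α₁+b*β₁ are the entries of L = P D Q in rows and columns v₁, v₂.
record CoreData (p : ℕ) : Set where
  field
    a b u α₀ α₁ β₀ β₁ x₀ x₁ y₀ y₁ : ℤ
    AA⁻¹₀₀ : α₀ * x₀ + α₁ * y₀ ≡ + 1
    AA⁻¹₀₁ : α₀ * x₁ + α₁ * y₁ ≡ + 0
    AA⁻¹₁₀ : β₀ * x₀ + β₁ * y₀ ≡ + 0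
    AA⁻¹₁₁ : β₀ * x₁ + β₁ * y₁ ≡ + 1
    A⁻¹A₀₀ : x₀ * α₀ + x₁ * β₀ ≡ + 1
    A⁻¹A₀₁ : x₀ * α₁ + x₁ * β₁ ≡ + 0
    A⁻¹A₁₀ : y₀ * α₀ + y₁ * β₀ ≡ + 0
    A⁻¹A₁₁ : y₀ * α₁ + y₁ * β₁ ≡ + 1
    a*α₀ : a * α₀ ≡ + suc (suc p)
    a*α₁ : a * α₁ ≡ triangle p - + 1
    ua*α₀+b*β₀ : u * a * α₀ + b * β₀ ≡ + 0
    ua*α₁+b*β₁ : u * a * α₁ + b * β₁ ≡ + suc (suc p)
    0≤a : + 0 ℤ.≤ a
    0≤b : + 0 ℤ.≤ b
    a∣b : a ℤ∣.∣ b

module SmithReduction (p : ℕ) (1≤p : 1 ≤ p) (core : CoreData p) where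

  open CoreData core

  n : ℕ
  n = 3 ℕ.+ p

  α₂ β₂ : ℤ
  α₂ = - (α₀ + α₁)
  β₂ = - (β₀ + β₁)

  -- Smith basis: p unit entries, then the slots of a, b and 0.
  basisVec : (ℕ → ℤ) → ℤ → ℤ → ℤ → ℕ → ℤ
  basisVec f x y z = prefixThen p f (slots x y z)

  -- Vertices: the axle v₁, the rim vertex v₂, the inner rim v₃ … v_{n-1}, and v_n.
  vertexVec : ℤ → ℤ → (ℕ → ℤ) → ℤ → ℕ → ℤ
  vertexVec z o f l 0             = z
  vertexVec z o f l 1             = o
  vertexVec z o f l (suc (suc r)) = prefixThen p f (λ _ → l) r

  basisVec-unit : ∀ f x y z {r} → r < p → basisVec f x y z r ≡ f r
  basisVec-unit f x y z = prefixThen-< p f (slots x y z)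

  basisVec-a : ∀ f x y z → basisVec f x y z p ≡ x
  basisVec-a f x y z = prefixThen-+ p f (slots x y z) 0

  basisVec-b : ∀ f x y z → basisVec f x y z (suc p) ≡ y
  basisVec-b f x y z = prefixThen-+ p f (slots x y z) 1

  basisVec-0 : ∀ f x y z → basisVec f x y z (suc (suc p)) ≡ z
  basisVec-0 f x y z = prefixThen-+ p f (slots x y z) 2

  vertexVec-inner : ∀ z o f l {r} → r < p → vertexVec z o f l (suc (suc r)) ≡ f r
  vertexVec-inner z o f l = prefixThen-< p f (λ _ → l)

  vertexVec-last : ∀ z o f l → vertexVec z o f l (suc (suc p)) ≡ l
  vertexVec-last z o f l = prefixThen-+ p f (λ _ → l) 0

  data BasisIndex : ℕ → Set where
    unit  : ∀ r → r < p → BasisIndex r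
    slotᵃ : BasisIndex p
    slotᵇ : BasisIndex (suc p)
    slot⁰ : BasisIndex (suc (suc p))

  basisIndex : ∀ k → k < n → BasisIndex k
  basisIndex k k<n with ℕP.<-cmp k p
  ... | tri< k<p _ _ = unit k k<p
  ... | tri≈ _ refl _ = slotᵃ
  ... | tri> _ _ p<k with ℕP.<-cmp k (suc p)
  ...   | tri< k<1+p _ _ = ⊥-elim (ℕP.<⇒≱ k<1+p p<k)
  ...   | tri≈ _ refl _ = slotᵇ
  ...   | tri> _ _ 1+p<k with ℕP.<-cmp k (suc (suc p))
  ...     | tri< k<2+p _ _ = ⊥-elim (ℕP.<⇒≱ k<2+p 1+p<k)
  ...     | tri≈ _ refl _ = slot⁰
  ...     | tri> _ _ 2+p<k = ⊥-elim (ℕP.<⇒≱ k<n 2+p<k)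

  data VertexIndex : ℕ → Set where
    axle  : VertexIndex 0
    rim₁  : VertexIndex 1
    inner : ∀ r → r < p → VertexIndex (suc (suc r))
    rimₘ  : VertexIndex (suc (suc p))

  vertexIndex : ∀ j → j < n → VertexIndex j
  vertexIndex zero          _ = axle
  vertexIndex (suc zero)    _ = rim₁
  vertexIndex (suc (suc r)) (s≤s (s≤s r≤p)) with ℕP.<-cmp r p
  ... | tri< r<p _ _ = inner r r<p
  ... | tri≈ _ refl _ = rimₘ
  ... | tri> _ _ p<r = ⊥-elim (ℕP.<⇒≱ r≤p p<r)

  ∑-basis : ∀ f → ∑ n f ≡ ∑ p f + f p + f (suc p) + f (suc (suc p))
  ∑-basis f = trans (∑-last (suc (suc p)) f)
                    (cong (_+ f (suc (suc p))) (trans (∑-last (suc p) f) (cong (_+ f (suc p)) (∑-last p f))))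

  ∑-vertices : ∀ f → ∑ n f ≡ f 0 + f 1 + (∑[ r < p ] f (suc (suc r))) + f (suc (suc p))
  ∑-vertices f = trans (cong (λ s → f 0 + (f 1 + s)) (∑-last p (λ r → f (suc (suc r)))))
                       (reassoc (f 0) (f 1) _ _)
    where
    reassoc : ∀ a b c d → a + (b + (c + d)) ≡ a + b + c + d
    reassoc = solve-∀

  basisVec-dot : ∀ f x y z f' x' y' z' →
    ∑[ k < n ] (basisVec f x y z k * basisVec f' x' y' z' k) ≡ (∑[ r < p ] (f r * f' r)) + x * x' + y * y' + z * z'
  basisVec-dot f x y z f' x' y' z' = trans (∑-basis (λ k → basisVec f x y z k * basisVec f' x' y' z' k))
    (cong₂ _+_ (cong₂ _+_ (cong₂ _+_
      (∑-cong p (λ r r<p → cong₂ _*_ (basisVec-unit f x y z r<p) (basisVec-unit f' x' y' z' r<p)))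
      (cong₂ _*_ (basisVec-a f x y z) (basisVec-a f' x' y' z')))
      (cong₂ _*_ (basisVec-b f x y z) (basisVec-b f' x' y' z')))
      (cong₂ _*_ (basisVec-0 f x y z) (basisVec-0 f' x' y' z')))

  vertexVec-dot : ∀ z o f l z' o' f' l' →
    ∑[ j < n ] (vertexVec z o f l j * vertexVec z' o' f' l' j) ≡ z * z' + o * o' + (∑[ r < p ] (f r * f' r)) + l * l'
  vertexVec-dot z o f l z' o' f' l' = trans (∑-vertices (λ j → vertexVec z o f l j * vertexVec z' o' f' l' j))
    (cong₂ _+_
      (cong (λ s → z * z' + o * o' + s)
        (∑-cong p (λ r r<p → cong₂ _*_ (vertexVec-inner z o f l r<p) (vertexVec-inner z' o' f' l' r<p))))
      (cong₂ _*_ (vertexVec-last z o f l) (vertexVec-last z' o' f' l')))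

  <p⇒<n : ∀ {r} → r < p → r < n
  <p⇒<n r<p = ℕP.<-≤-trans r<p (ℕP.m≤n+m p 3)

  innerSum : (ℕ → ℤ) → ℕ → ℤ
  innerSum g j = ∑[ r < p ] (g r * δ (suc (suc r)) j)

  innerSum-axle : ∀ g → innerSum g 0 ≡ + 0
  innerSum-axle = ∑-*-zero p

  innerSum-rim₁ : ∀ g → innerSum g 1 ≡ + 0
  innerSum-rim₁ = ∑-*-zero p

  innerSum-inner : ∀ g {s} → s < p → innerSum g (suc (suc s)) ≡ g s
  innerSum-inner g {s} s<p = trans (∑-*-δ≡prefixThen p g s) (prefixThen-< p g (λ _ → + 0) s<p)

  innerSum-rimₘ : ∀ g → innerSum g (suc (suc p)) ≡ + 0
  innerSum-rimₘ g = trans (∑-*-δ≡prefixThen p g p) (prefixThen-≥ p g (+ 0) ℕP.≤-refl)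

  unitSum : (ℕ → ℤ) → ℕ → ℤ
  unitSum g k = ∑[ r < p ] (g r * δ r k)

  unitSum-unit : ∀ g {s} → s < p → unitSum g s ≡ g s
  unitSum-unit g {s} s<p = trans (∑-*-δ≡prefixThen p g s) (prefixThen-< p g (λ _ → + 0) s<p)

  unitSum-slot : ∀ g {k} → p ≤ k → unitSum g k ≡ + 0
  unitSum-slot g {k} p≤k = trans (∑-*-δ≡prefixThen p g k) (prefixThen-≥ p g (+ 0) p≤k)

  -- The row transformation P and its inverse P'

  P₀ P₁ Pₘ : ℕ → ℤ
  P₀ = basisVec (λ k → triangle (p ∸ k)) (+ 1) (+ 0) (+ 0)
  P₁ = basisVec (λ k → + (p ∸ k)) u (+ 1) (+ 0)
  Pₘ = basisVec (λ k → - + suc (p ∸ k)) (- u) (- + 1) (+ 1)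

  P : ℕ → ℕ → ℤ
  P i k = vertexVec (P₀ k) (P₁ k) (λ r → δ r k) (Pₘ k) i

  P'ᵃ P'ᵇ P'⁰ : ℕ → ℤ
  P'ᵃ = vertexVec (+ 1) (+ 0) (λ r → - triangle (p ∸ r)) (+ 0)
  P'ᵇ = vertexVec (- u) (+ 1) (λ r → - + (p ∸ r) + u * triangle (p ∸ r)) (+ 0)
  P'⁰ = vertexVec (+ 0) (+ 1) (λ _ → + 1) (+ 1)

  P' : ℕ → ℕ → ℤ
  P' k j = basisVec (λ r → δ (suc (suc r)) j) (P'ᵃ j) (P'ᵇ j) (P'⁰ j) k

  P'ᵃ-inner : ∀ {s} → s < p → P'ᵃ (suc (suc s)) ≡ - triangle (p ∸ s)
  P'ᵃ-inner = vertexVec-inner (+ 1) (+ 0) (λ r → - triangle (p ∸ r)) (+ 0)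

  P'ᵃ-last : P'ᵃ (suc (suc p)) ≡ + 0
  P'ᵃ-last = vertexVec-last (+ 1) (+ 0) (λ r → - triangle (p ∸ r)) (+ 0)

  P'ᵇ-inner : ∀ {s} → s < p → P'ᵇ (suc (suc s)) ≡ - + (p ∸ s) + u * triangle (p ∸ s)
  P'ᵇ-inner = vertexVec-inner (- u) (+ 1) (λ r → - + (p ∸ r) + u * triangle (p ∸ r)) (+ 0)

  P'ᵇ-last : P'ᵇ (suc (suc p)) ≡ + 0
  P'ᵇ-last = vertexVec-last (- u) (+ 1) (λ r → - + (p ∸ r) + u * triangle (p ∸ r)) (+ 0)

  P'⁰-inner : ∀ {s} → s < p → P'⁰ (suc (suc s)) ≡ + 1
  P'⁰-inner = vertexVec-inner (+ 0) (+ 1) (λ _ → + 1) (+ 1)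

  P'⁰-last : P'⁰ (suc (suc p)) ≡ + 1
  P'⁰-last = vertexVec-last (+ 0) (+ 1) (λ _ → + 1) (+ 1)

  P₀-unit : ∀ {s} → s < p → P₀ s ≡ triangle (p ∸ s)
  P₀-unit = basisVec-unit (λ k → triangle (p ∸ k)) (+ 1) (+ 0) (+ 0)

  P₁-unit : ∀ {s} → s < p → P₁ s ≡ + (p ∸ s)
  P₁-unit = basisVec-unit (λ k → + (p ∸ k)) u (+ 1) (+ 0)

  Pₘ-unit : ∀ {s} → s < p → Pₘ s ≡ - + suc (p ∸ s)
  Pₘ-unit = basisVec-unit (λ k → - + suc (p ∸ k)) (- u) (- + 1) (+ 1)

  P₀-a : P₀ p ≡ + 1
  P₀-a = basisVec-a (λ k → triangle (p ∸ k)) (+ 1) (+ 0) (+ 0)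
  P₀-b : P₀ (suc p) ≡ + 0
  P₀-b = basisVec-b (λ k → triangle (p ∸ k)) (+ 1) (+ 0) (+ 0)
  P₀-0 : P₀ (suc (suc p)) ≡ + 0
  P₀-0 = basisVec-0 (λ k → triangle (p ∸ k)) (+ 1) (+ 0) (+ 0)
  P₁-a : P₁ p ≡ u
  P₁-a = basisVec-a (λ k → + (p ∸ k)) u (+ 1) (+ 0)
  P₁-b : P₁ (suc p) ≡ + 1
  P₁-b = basisVec-b (λ k → + (p ∸ k)) u (+ 1) (+ 0)
  P₁-0 : P₁ (suc (suc p)) ≡ + 0
  P₁-0 = basisVec-0 (λ k → + (p ∸ k)) u (+ 1) (+ 0)
  Pₘ-a : Pₘ p ≡ - u
  Pₘ-a = basisVec-a (λ k → - + suc (p ∸ k)) (- u) (- + 1) (+ 1)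
  Pₘ-b : Pₘ (suc p) ≡ - + 1
  Pₘ-b = basisVec-b (λ k → - + suc (p ∸ k)) (- u) (- + 1) (+ 1)
  Pₘ-0 : Pₘ (suc (suc p)) ≡ + 1
  Pₘ-0 = basisVec-0 (λ k → - + suc (p ∸ k)) (- u) (- + 1) (+ 1)

  P·P'≡δ : ∀ i j → i < n → j < n → ∑[ k < n ] (P i k * P' k j) ≡ δ i j
  P·P'≡δ i j i<n j<n with vertexIndex i i<n
  ... | inner r r<p =
    trans (∑-cong n (λ k _ → cong (_* P' k j) (vertexVec-inner (P₀ k) (P₁ k) (λ r → δ r k) (Pₘ k) r<p)))
    (trans (∑-δ n r (λ k → P' k j) (<p⇒<n r<p)) (basisVec-unit _ (P'ᵃ j) (P'ᵇ j) (P'⁰ j) r<p))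
  ... | axle =
    trans (basisVec-dot _ (+ 1) (+ 0) (+ 0) (λ r → δ (suc (suc r)) j) (P'ᵃ j) (P'ᵇ j) (P'⁰ j)) (column j j<n)
    where
    g : ℕ → ℤ
    g k = triangle (p ∸ k)
    column : ∀ j → j < n → innerSum g j + + 1 * P'ᵃ j + + 0 * P'ᵇ j + + 0 * P'⁰ j ≡ δ 0 j
    column j j<n with vertexIndex j j<n
    ... | axle rewrite innerSum-axle g = refl
    ... | rim₁ rewrite innerSum-rim₁ g = refl
    ... | inner s s<p rewrite innerSum-inner g s<p | P'ᵃ-inner s<p = ring (g s)
      where ring : ∀ t → t + + 1 * - t + + 0 + + 0 ≡ + 0
            ring = solve-∀
    ... | rimₘ rewrite innerSum-rimₘ g | P'ᵃ-last = refl
  ... | rim₁ =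
    trans (basisVec-dot _ u (+ 1) (+ 0) (λ r → δ (suc (suc r)) j) (P'ᵃ j) (P'ᵇ j) (P'⁰ j)) (column j j<n)
    where
    g : ℕ → ℤ
    g k = + (p ∸ k)
    column : ∀ j → j < n → innerSum g j + u * P'ᵃ j + + 1 * P'ᵇ j + + 0 * P'⁰ j ≡ δ 1 j
    column j j<n with vertexIndex j j<n
    ... | axle rewrite innerSum-axle g = ring u
      where ring : ∀ u → + 0 + u * + 1 + + 1 * - u + + 0 ≡ + 0
            ring = solve-∀
    ... | rim₁ rewrite innerSum-rim₁ g = ring u
      where ring : ∀ u → + 0 + u * + 0 + + 1 * + 1 + + 0 ≡ + 1
            ring = solve-∀
    ... | inner s s<p rewrite innerSum-inner g s<p | P'ᵃ-inner s<p | P'ᵇ-inner s<p = ring (g s) (triangle (p ∸ s)) u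
      where ring : ∀ a t u → a + u * - t + + 1 * (- a + u * t) + + 0 ≡ + 0
            ring = solve-∀
    ... | rimₘ rewrite innerSum-rimₘ g | P'ᵃ-last | P'ᵇ-last = ring u
      where ring : ∀ u → + 0 + u * + 0 + + 1 * + 0 + + 0 ≡ + 0
            ring = solve-∀
  ... | rimₘ =
    trans (∑-cong n (λ k _ → cong (_* P' k j) (vertexVec-last (P₀ k) (P₁ k) (λ r → δ r k) (Pₘ k))))
    (trans (basisVec-dot _ (- u) (- + 1) (+ 1) (λ r → δ (suc (suc r)) j) (P'ᵃ j) (P'ᵇ j) (P'⁰ j)) (column j j<n))
    where
    g : ℕ → ℤ
    g k = - + suc (p ∸ k)
    column : ∀ j → j < n → innerSum g j + - u * P'ᵃ j + - + 1 * P'ᵇ j + + 1 * P'⁰ j ≡ δ (suc (suc p)) j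
    column j j<n with vertexIndex j j<n
    ... | axle rewrite innerSum-axle g = ring u
      where ring : ∀ u → + 0 + - u * + 1 + - + 1 * - u + + 1 * + 0 ≡ + 0
            ring = solve-∀
    ... | rim₁ rewrite innerSum-rim₁ g = ring u
      where ring : ∀ u → + 0 + - u * + 0 + - + 1 * + 1 + + 1 * + 1 ≡ + 0
            ring = solve-∀
    ... | inner s s<p rewrite innerSum-inner g s<p | P'ᵃ-inner s<p | P'ᵇ-inner s<p | P'⁰-inner s<p | δ-> s<p
      = ring (+ (p ∸ s)) (triangle (p ∸ s)) u
      where ring : ∀ a t u → - (+ 1 + a) + - u * - t + - + 1 * (- a + u * t) + + 1 * + 1 ≡ + 0
            ring = solve-∀
    ... | rimₘ rewrite innerSum-rimₘ g | P'ᵃ-last | P'ᵇ-last | P'⁰-last | δ-refl p = ring u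
      where ring : ∀ u → + 0 + - u * + 0 + - + 1 * + 0 + + 1 * + 1 ≡ + 1
            ring = solve-∀

  P'·P≡δ : ∀ i j → i < n → j < n → ∑[ v < n ] (P' i v * P v j) ≡ δ i j
  P'·P≡δ i j i<n j<n with basisIndex i i<n
  ... | unit r r<p =
    trans (∑-cong n (λ v _ → cong (_* P v j) (basisVec-unit (λ r → δ (suc (suc r)) v) (P'ᵃ v) (P'ᵇ v) (P'⁰ v) r<p)))
    (trans (∑-δ n (suc (suc r)) (λ v → P v j) (s≤s (s≤s (ℕP.m≤n⇒m≤1+n r<p))))
           (vertexVec-inner (P₀ j) (P₁ j) (λ r → δ r j) (Pₘ j) r<p))
  ... | slotᵃ =
    trans (∑-cong n (λ v _ → cong (_* P v j) (basisVec-a (λ r → δ (suc (suc r)) v) (P'ᵃ v) (P'ᵇ v) (P'⁰ v))))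
    (trans (vertexVec-dot (+ 1) (+ 0) g (+ 0) (P₀ j) (P₁ j) (λ r → δ r j) (Pₘ j)) (column j j<n))
    where
    g : ℕ → ℤ
    g r = - triangle (p ∸ r)
    column : ∀ j → j < n → + 1 * P₀ j + + 0 * P₁ j + unitSum g j + + 0 * Pₘ j ≡ δ p j
    column j j<n with basisIndex j j<n
    ... | unit s s<p rewrite unitSum-unit g s<p | P₀-unit s<p | δ-> s<p = ring (triangle (p ∸ s))
      where ring : ∀ t → + 1 * t + + 0 + - t + + 0 ≡ + 0
            ring = solve-∀
    ... | slotᵃ rewrite unitSum-slot g ℕP.≤-refl | P₀-a | δ-refl p = refl
    ... | slotᵇ rewrite unitSum-slot g (ℕP.n≤1+n p) | P₀-b | δ-< (ℕP.n<1+n p) = refl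
    ... | slot⁰ rewrite unitSum-slot g (ℕP.m≤n+m p 2) | P₀-0 | δ-< (ℕP.m<n+m p {2} (s≤s z≤n)) = refl
  ... | slotᵇ =
    trans (∑-cong n (λ v _ → cong (_* P v j) (basisVec-b (λ r → δ (suc (suc r)) v) (P'ᵃ v) (P'ᵇ v) (P'⁰ v))))
    (trans (vertexVec-dot (- u) (+ 1) g (+ 0) (P₀ j) (P₁ j) (λ r → δ r j) (Pₘ j)) (column j j<n))
    where
    g : ℕ → ℤ
    g r = - + (p ∸ r) + u * triangle (p ∸ r)
    column : ∀ j → j < n → - u * P₀ j + + 1 * P₁ j + unitSum g j + + 0 * Pₘ j ≡ δ (suc p) j
    column j j<n with basisIndex j j<n
    ... | unit s s<p rewrite unitSum-unit g s<p | P₀-unit s<p | P₁-unit s<p | δ-> (ℕP.m<n⇒m<1+n s<p)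
      = ring (triangle (p ∸ s)) (+ (p ∸ s)) u
      where ring : ∀ t a u → - u * t + + 1 * a + (- a + u * t) + + 0 ≡ + 0
            ring = solve-∀
    ... | slotᵃ rewrite unitSum-slot g ℕP.≤-refl | P₀-a | P₁-a | δ-> (ℕP.n<1+n p) = ring u
      where ring : ∀ u → - u * + 1 + + 1 * u + + 0 + + 0 ≡ + 0
            ring = solve-∀
    ... | slotᵇ rewrite unitSum-slot g (ℕP.n≤1+n p) | P₀-b | P₁-b | δ-refl p = ring u
      where ring : ∀ u → - u * + 0 + + 1 * + 1 + + 0 + + 0 ≡ + 1
            ring = solve-∀
    ... | slot⁰ rewrite unitSum-slot g (ℕP.m≤n+m p 2) | P₀-0 | P₁-0 | δ-< (ℕP.n<1+n (suc p)) = ring u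
      where ring : ∀ u → - u * + 0 + + 1 * + 0 + + 0 + + 0 ≡ + 0
            ring = solve-∀
  ... | slot⁰ =
    trans (∑-cong n (λ v _ → cong (_* P v j) (basisVec-0 (λ r → δ (suc (suc r)) v) (P'ᵃ v) (P'ᵇ v) (P'⁰ v))))
    (trans (vertexVec-dot (+ 0) (+ 1) g (+ 1) (P₀ j) (P₁ j) (λ r → δ r j) (Pₘ j)) (column j j<n))
    where
    g : ℕ → ℤ
    g _ = + 1
    column : ∀ j → j < n → + 0 * P₀ j + + 1 * P₁ j + unitSum g j + + 1 * Pₘ j ≡ δ (suc (suc p)) j
    column j j<n with basisIndex j j<n
    ... | unit s s<p rewrite unitSum-unit g s<p | P₁-unit s<p | Pₘ-unit s<p | δ-> (ℕP.m<n⇒m<1+n (ℕP.m<n⇒m<1+n s<p))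
      = ring (+ (p ∸ s))
      where ring : ∀ a → + 0 + + 1 * a + + 1 + + 1 * - (+ 1 + a) ≡ + 0
            ring = solve-∀
    ... | slotᵃ rewrite unitSum-slot g ℕP.≤-refl | P₁-a | Pₘ-a | δ-> (ℕP.m<n⇒m<1+n (ℕP.n<1+n p)) = ring u
      where ring : ∀ u → + 0 + + 1 * u + + 0 + + 1 * - u ≡ + 0
            ring = solve-∀
    ... | slotᵇ rewrite unitSum-slot g (ℕP.n≤1+n p) | P₁-b | Pₘ-b | δ-> (ℕP.n<1+n (suc p)) = refl
    ... | slot⁰ rewrite unitSum-slot g (ℕP.m≤n+m p 2) | P₁-0 | Pₘ-0 | δ-refl p = refl

  -- The column transformation Q and its inverse Q'

  qᵃ qᵇ : ℕ → ℤ
  qᵃ j = α₀ * δ 0 j + α₁ * δ 1 j + α₂ * δ 2 j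
  qᵇ j = β₀ * δ 0 j + β₁ * δ 1 j + β₂ * δ 2 j

  Q : ℕ → ℕ → ℤ
  Q k j = basisVec (λ r → innerRow r j) (qᵃ j) (qᵇ j) (δ 2 j) k

  Q'₀ : ℕ → ℤ
  Q'₀ = basisVec (λ _ → + 0) x₀ x₁ (+ 1)

  Q'ᵣ : ℕ → ℕ → ℤ
  Q'ᵣ i = basisVec (λ r → - + ((i ∸ 2) ∸ r)) ((+ 2 - + i) * y₀) ((+ 2 - + i) * y₁) (+ 1)

  Q' : ℕ → ℕ → ℤ
  Q' zero    = Q'₀
  Q' (suc i) = Q'ᵣ (suc i)

  Q'₀-unit : ∀ {s} → s < p → Q'₀ s ≡ + 0
  Q'₀-unit = basisVec-unit (λ _ → + 0) x₀ x₁ (+ 1)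

  Q'₀-a : Q'₀ p ≡ x₀
  Q'₀-a = basisVec-a (λ _ → + 0) x₀ x₁ (+ 1)

  Q'₀-b : Q'₀ (suc p) ≡ x₁
  Q'₀-b = basisVec-b (λ _ → + 0) x₀ x₁ (+ 1)

  Q'₀-0 : Q'₀ (suc (suc p)) ≡ + 1
  Q'₀-0 = basisVec-0 (λ _ → + 0) x₀ x₁ (+ 1)

  Q'ᵣ-unit : ∀ i {s} → s < p → Q'ᵣ i s ≡ - + ((i ∸ 2) ∸ s)
  Q'ᵣ-unit i = basisVec-unit (λ r → - + ((i ∸ 2) ∸ r)) ((+ 2 - + i) * y₀) ((+ 2 - + i) * y₁) (+ 1)

  Q'ᵣ-a : ∀ i → Q'ᵣ i p ≡ (+ 2 - + i) * y₀
  Q'ᵣ-a i = basisVec-a (λ r → - + ((i ∸ 2) ∸ r)) ((+ 2 - + i) * y₀) ((+ 2 - + i) * y₁) (+ 1)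

  Q'ᵣ-b : ∀ i → Q'ᵣ i (suc p) ≡ (+ 2 - + i) * y₁
  Q'ᵣ-b i = basisVec-b (λ r → - + ((i ∸ 2) ∸ r)) ((+ 2 - + i) * y₀) ((+ 2 - + i) * y₁) (+ 1)

  Q'ᵣ-0 : ∀ i → Q'ᵣ i (suc (suc p)) ≡ + 1
  Q'ᵣ-0 i = basisVec-0 (λ r → - + ((i ∸ 2) ∸ r)) ((+ 2 - + i) * y₀) ((+ 2 - + i) * y₁) (+ 1)

  3≤n : 3 ≤ n
  3≤n = s≤s (s≤s (s≤s z≤n))

  Q·Q'≡δ : ∀ i j → i < n → j < n → ∑[ v < n ] (Q i v * Q' v j) ≡ δ i j
  Q·Q'≡δ i j i<n j<n with basisIndex i i<n
  ... | unit r r<p =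
    trans (∑-cong n (λ v _ → cong (_* Q' v j) (basisVec-unit (λ r → innerRow r v) (qᵃ v) (qᵇ v) (δ 2 v) r<p)))
    (trans (∑-innerRow-* n r (λ v → Q' v j) (s≤s (s≤s (s≤s r<p)))) (column j j<n))
    where
    column : ∀ j → j < n → + 2 * Q'ᵣ (suc (suc r)) j - Q'ᵣ (suc r) j - Q'ᵣ (suc (suc (suc r))) j ≡ δ r j
    column j j<n with basisIndex j j<n
    ... | unit s s<p rewrite Q'ᵣ-unit (suc (suc r)) s<p | Q'ᵣ-unit (suc r) s<p | Q'ᵣ-unit (suc (suc (suc r))) s<p
                           | ℕP.∸-+-assoc r 1 s = ramp-Δ² r s
    ... | slotᵃ rewrite Q'ᵣ-a (suc (suc r)) | Q'ᵣ-a (suc r) | Q'ᵣ-a (suc (suc (suc r))) | δ-< r<p = ring (+ r) y₀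
      where ring : ∀ a y → + 2 * ((+ 2 - (+ 2 + a)) * y) - (+ 2 - (+ 1 + a)) * y - (+ 2 - (+ 3 + a)) * y ≡ + 0
            ring = solve-∀
    ... | slotᵇ rewrite Q'ᵣ-b (suc (suc r)) | Q'ᵣ-b (suc r) | Q'ᵣ-b (suc (suc (suc r))) | δ-< (ℕP.m<n⇒m<1+n r<p)
      = ring (+ r) y₁
      where ring : ∀ a y → + 2 * ((+ 2 - (+ 2 + a)) * y) - (+ 2 - (+ 1 + a)) * y - (+ 2 - (+ 3 + a)) * y ≡ + 0
            ring = solve-∀
    ... | slot⁰ rewrite Q'ᵣ-0 (suc (suc r)) | Q'ᵣ-0 (suc r) | Q'ᵣ-0 (suc (suc (suc r)))
                      | δ-< (ℕP.m<n⇒m<1+n (ℕP.m<n⇒m<1+n r<p)) = refl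
  ... | slotᵃ =
    trans (∑-cong n (λ v _ → cong (_* Q' v j) (basisVec-a (λ r → innerRow r v) (qᵃ v) (qᵇ v) (δ 2 v))))
    (trans (∑-δ₀₁₂-* n α₀ α₁ α₂ (λ v → Q' v j) 3≤n) (column j j<n))
    where
    column : ∀ j → j < n → α₀ * Q'₀ j + α₁ * Q'ᵣ 1 j + α₂ * Q'ᵣ 2 j ≡ δ p j
    column j j<n with basisIndex j j<n
    ... | unit s s<p rewrite Q'₀-unit s<p | Q'ᵣ-unit 1 s<p | Q'ᵣ-unit 2 s<p | ℕP.0∸n≡0 s | δ-> s<p = ring α₀ α₁ α₂
      where ring : ∀ a b c → a * + 0 + b * - + 0 + c * - + 0 ≡ + 0
            ring = solve-∀
    ... | slotᵃ rewrite Q'₀-a | Q'ᵣ-a 1 | Q'ᵣ-a 2 | δ-refl p = trans (ring α₀ α₁ α₂ x₀ y₀) AA⁻¹₀₀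
      where ring : ∀ a b c x y → a * x + b * ((+ 2 - + 1) * y) + c * ((+ 2 - + 2) * y) ≡ a * x + b * y
            ring = solve-∀
    ... | slotᵇ rewrite Q'₀-b | Q'ᵣ-b 1 | Q'ᵣ-b 2 | δ-< (ℕP.n<1+n p) = trans (ring α₀ α₁ α₂ x₁ y₁) AA⁻¹₀₁
      where ring : ∀ a b c x y → a * x + b * ((+ 2 - + 1) * y) + c * ((+ 2 - + 2) * y) ≡ a * x + b * y
            ring = solve-∀
    ... | slot⁰ rewrite Q'₀-0 | Q'ᵣ-0 1 | Q'ᵣ-0 2 | δ-< (ℕP.m<n⇒m<1+n (ℕP.n<1+n p)) = ring α₀ α₁
      where ring : ∀ a b → a * + 1 + b * + 1 + - (a + b) * + 1 ≡ + 0
            ring = solve-∀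
  ... | slotᵇ =
    trans (∑-cong n (λ v _ → cong (_* Q' v j) (basisVec-b (λ r → innerRow r v) (qᵃ v) (qᵇ v) (δ 2 v))))
    (trans (∑-δ₀₁₂-* n β₀ β₁ β₂ (λ v → Q' v j) 3≤n) (column j j<n))
    where
    column : ∀ j → j < n → β₀ * Q'₀ j + β₁ * Q'ᵣ 1 j + β₂ * Q'ᵣ 2 j ≡ δ (suc p) j
    column j j<n with basisIndex j j<n
    ... | unit s s<p rewrite Q'₀-unit s<p | Q'ᵣ-unit 1 s<p | Q'ᵣ-unit 2 s<p | ℕP.0∸n≡0 s
                           | δ-> (ℕP.m<n⇒m<1+n s<p) = ring β₀ β₁ β₂
      where ring : ∀ a b c → a * + 0 + b * - + 0 + c * - + 0 ≡ + 0
            ring = solve-∀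
    ... | slotᵃ rewrite Q'₀-a | Q'ᵣ-a 1 | Q'ᵣ-a 2 | δ-> (ℕP.n<1+n p) = trans (ring β₀ β₁ β₂ x₀ y₀) AA⁻¹₁₀
      where ring : ∀ a b c x y → a * x + b * ((+ 2 - + 1) * y) + c * ((+ 2 - + 2) * y) ≡ a * x + b * y
            ring = solve-∀
    ... | slotᵇ rewrite Q'₀-b | Q'ᵣ-b 1 | Q'ᵣ-b 2 | δ-refl p = trans (ring β₀ β₁ β₂ x₁ y₁) AA⁻¹₁₁
      where ring : ∀ a b c x y → a * x + b * ((+ 2 - + 1) * y) + c * ((+ 2 - + 2) * y) ≡ a * x + b * y
            ring = solve-∀
    ... | slot⁰ rewrite Q'₀-0 | Q'ᵣ-0 1 | Q'ᵣ-0 2 | δ-< (ℕP.n<1+n (suc p)) = ring β₀ β₁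
      where ring : ∀ a b → a * + 1 + b * + 1 + - (a + b) * + 1 ≡ + 0
            ring = solve-∀
  ... | slot⁰ =
    trans (∑-cong n (λ v _ → cong (_* Q' v j) (basisVec-0 (λ r → innerRow r v) (qᵃ v) (qᵇ v) (δ 2 v))))
    (trans (∑-δ n 2 (λ v → Q' v j) 3≤n) (column j j<n))
    where
    column : ∀ j → j < n → Q'ᵣ 2 j ≡ δ (suc (suc p)) j
    column j j<n with basisIndex j j<n
    ... | unit s s<p rewrite Q'ᵣ-unit 2 s<p | ℕP.0∸n≡0 s | δ-> (ℕP.m<n⇒m<1+n (ℕP.m<n⇒m<1+n s<p)) = refl
    ... | slotᵃ rewrite Q'ᵣ-a 2 | δ-> (ℕP.m<n⇒m<1+n (ℕP.n<1+n p)) = ℤP.*-zeroˡ y₀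
    ... | slotᵇ rewrite Q'ᵣ-b 2 | δ-> (ℕP.n<1+n (suc p)) = ℤP.*-zeroˡ y₁
    ... | slot⁰ rewrite Q'ᵣ-0 2 | δ-refl p = refl

  Q'·Q≡δ : ∀ i j → i < n → j < n → ∑[ k < n ] (Q' i k * Q k j) ≡ δ i j
  Q'·Q≡δ zero j _ _ =
    trans (basisVec-dot (λ _ → + 0) x₀ x₁ (+ 1) (λ r → innerRow r j) (qᵃ j) (qᵇ j) (δ 2 j))
    (trans (cong (λ s → s + x₀ * qᵃ j + x₁ * qᵇ j + + 1 * δ 2 j) (∑-zero p)) (column j))
    where
    column : ∀ j → + 0 + x₀ * qᵃ j + x₁ * qᵇ j + + 1 * δ 2 j ≡ δ 0 j
    column 0 = trans (ring x₀ x₁ α₀ α₁ β₀ β₁) A⁻¹A₀₀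
      where ring : ∀ x₀ x₁ a₀ a₁ b₀ b₁ → + 0 + x₀ * (a₀ * + 1 + a₁ * + 0 + - (a₀ + a₁) * + 0)
                                      + x₁ * (b₀ * + 1 + b₁ * + 0 + - (b₀ + b₁) * + 0) + + 1 * + 0 ≡ x₀ * a₀ + x₁ * b₀
            ring = solve-∀
    column 1 = trans (ring x₀ x₁ α₀ α₁ β₀ β₁) A⁻¹A₀₁
      where ring : ∀ x₀ x₁ a₀ a₁ b₀ b₁ → + 0 + x₀ * (a₀ * + 0 + a₁ * + 1 + - (a₀ + a₁) * + 0)
                                      + x₁ * (b₀ * + 0 + b₁ * + 1 + - (b₀ + b₁) * + 0) + + 1 * + 0 ≡ x₀ * a₁ + x₁ * b₁
            ring = solve-∀
    column 2 = trans (ring x₀ x₁ α₀ α₁ β₀ β₁) (cong₂ (λ s t → + 1 - s - t) A⁻¹A₀₀ A⁻¹A₀₁)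
      where ring : ∀ x₀ x₁ a₀ a₁ b₀ b₁ → + 0 + x₀ * (a₀ * + 0 + a₁ * + 0 + - (a₀ + a₁) * + 1)
                                      + x₁ * (b₀ * + 0 + b₁ * + 0 + - (b₀ + b₁) * + 1) + + 1 * + 1
                                      ≡ + 1 - (x₀ * a₀ + x₁ * b₀) - (x₀ * a₁ + x₁ * b₁)
            ring = solve-∀
    column (suc (suc (suc _))) = ring x₀ x₁ α₀ α₁ β₀ β₁
      where ring : ∀ x₀ x₁ a₀ a₁ b₀ b₁ → + 0 + x₀ * (a₀ * + 0 + a₁ * + 0 + - (a₀ + a₁) * + 0)
                                      + x₁ * (b₀ * + 0 + b₁ * + 0 + - (b₀ + b₁) * + 0) + + 1 * + 0 ≡ + 0
            ring = solve-∀
  Q'·Q≡δ (suc zero) j _ _ =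
    trans (basisVec-dot _ ((+ 2 - + 1) * y₀) ((+ 2 - + 1) * y₁) (+ 1) (λ r → innerRow r j) (qᵃ j) (qᵇ j) (δ 2 j))
    (trans (cong (λ s → s + (+ 2 - + 1) * y₀ * qᵃ j + (+ 2 - + 1) * y₁ * qᵇ j + + 1 * δ 2 j) main) (column j))
    where
    main : ∑[ r < p ] (- + (0 ∸ r) * innerRow r j) ≡ + 0
    main = trans (∑-cong p (λ r _ → cong (λ x → - + x * innerRow r j) (ℕP.0∸n≡0 r))) (∑-zero p)
    column : ∀ j → + 0 + (+ 2 - + 1) * y₀ * qᵃ j + (+ 2 - + 1) * y₁ * qᵇ j + + 1 * δ 2 j ≡ δ 1 j
    column 0 = trans (ring y₀ y₁ α₀ α₁ β₀ β₁) A⁻¹A₁₀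
      where ring : ∀ y₀ y₁ a₀ a₁ b₀ b₁ → + 0 + (+ 2 - + 1) * y₀ * (a₀ * + 1 + a₁ * + 0 + - (a₀ + a₁) * + 0)
                                      + (+ 2 - + 1) * y₁ * (b₀ * + 1 + b₁ * + 0 + - (b₀ + b₁) * + 0) + + 1 * + 0
                                      ≡ y₀ * a₀ + y₁ * b₀
            ring = solve-∀
    column 1 = trans (ring y₀ y₁ α₀ α₁ β₀ β₁) A⁻¹A₁₁
      where ring : ∀ y₀ y₁ a₀ a₁ b₀ b₁ → + 0 + (+ 2 - + 1) * y₀ * (a₀ * + 0 + a₁ * + 1 + - (a₀ + a₁) * + 0)
                                      + (+ 2 - + 1) * y₁ * (b₀ * + 0 + b₁ * + 1 + - (b₀ + b₁) * + 0) + + 1 * + 0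
                                      ≡ y₀ * a₁ + y₁ * b₁
            ring = solve-∀
    column 2 = trans (ring y₀ y₁ α₀ α₁ β₀ β₁) (cong₂ (λ s t → + 1 - s - t) A⁻¹A₁₀ A⁻¹A₁₁)
      where ring : ∀ y₀ y₁ a₀ a₁ b₀ b₁ → + 0 + (+ 2 - + 1) * y₀ * (a₀ * + 0 + a₁ * + 0 + - (a₀ + a₁) * + 1)
                                      + (+ 2 - + 1) * y₁ * (b₀ * + 0 + b₁ * + 0 + - (b₀ + b₁) * + 1) + + 1 * + 1
                                      ≡ + 1 - (y₀ * a₀ + y₁ * b₀) - (y₀ * a₁ + y₁ * b₁)
            ring = solve-∀
    column (suc (suc (suc _))) = ring y₀ y₁ α₀ α₁ β₀ β₁
      where ring : ∀ y₀ y₁ a₀ a₁ b₀ b₁ → + 0 + (+ 2 - + 1) * y₀ * (a₀ * + 0 + a₁ * + 0 + - (a₀ + a₁) * + 0)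
                                      + (+ 2 - + 1) * y₁ * (b₀ * + 0 + b₁ * + 0 + - (b₀ + b₁) * + 0) + + 1 * + 0 ≡ + 0
            ring = solve-∀
  Q'·Q≡δ (suc (suc c)) j (s≤s (s≤s (s≤s c≤p))) _ =
    trans (basisVec-dot _ (t * y₀) (t * y₁) (+ 1) (λ r → innerRow r j) (qᵃ j) (qᵇ j) (δ 2 j))
    (trans (cong (λ s → s + t * y₀ * qᵃ j + t * y₁ * qᵇ j + + 1 * δ 2 j)
                 (∑-*-innerRow-vanishing p ramp ramp≥p≡0 j))
           (column j))
    where
    t : ℤ
    t = + 2 - + suc (suc c)
    ramp : ℕ → ℤ
    ramp r = - + (c ∸ r)
    ramp≥p≡0 : ∀ r → p ≤ r → ramp r ≡ + 0
    ramp≥p≡0 r p≤r = cong (λ x → - + x) (ℕP.m≤n⇒m∸n≡0 (ℕP.≤-trans c≤p p≤r))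
    column : ∀ j → Δ² ramp j + t * y₀ * qᵃ j + t * y₁ * qᵇ j + + 1 * δ 2 j ≡ δ (suc (suc c)) j
    column 0 = trans (ring t y₀ y₁ α₀ α₁ β₀ β₁) (trans (cong (t *_) A⁻¹A₁₀) (ℤP.*-zeroʳ t))
      where ring : ∀ t y₀ y₁ a₀ a₁ b₀ b₁ → + 0 + t * y₀ * (a₀ * + 1 + a₁ * + 0 + - (a₀ + a₁) * + 0)
                                      + t * y₁ * (b₀ * + 1 + b₁ * + 0 + - (b₀ + b₁) * + 0) + + 1 * + 0
                                      ≡ t * (y₀ * a₀ + y₁ * b₀)
            ring = solve-∀
    column 1 = trans (ring (+ c) y₀ y₁ α₀ α₁ β₀ β₁) (trans (cong (λ s → + c - + c * s) A⁻¹A₁₁) (ring′ (+ c)))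
      where ring : ∀ c y₀ y₁ a₀ a₁ b₀ b₁ → - - c + (+ 2 - (+ 2 + c)) * y₀ * (a₀ * + 0 + a₁ * + 1 + - (a₀ + a₁) * + 0)
                                      + (+ 2 - (+ 2 + c)) * y₁ * (b₀ * + 0 + b₁ * + 1 + - (b₀ + b₁) * + 0) + + 1 * + 0
                                      ≡ c - c * (y₀ * a₁ + y₁ * b₁)
            ring = solve-∀
            ring′ : ∀ c → c - c * + 1 ≡ + 0
            ring′ = solve-∀
    column 2 = trans (ring (+ c) (+ (c ∸ 1)) y₀ y₁ α₀ α₁ β₀ β₁)
                     (trans (cong₂ (λ s t → + (c ∸ 1) - + 2 * + c + + c * (s + t) + + 1) A⁻¹A₁₀ A⁻¹A₁₁) (centre c))
      where ring : ∀ c d y₀ y₁ a₀ a₁ b₀ b₁ → + 2 * - c - - d + (+ 2 - (+ 2 + c)) * y₀ * (a₀ * + 0 + a₁ * + 0 + - (a₀ + a₁) * + 1)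
                                      + (+ 2 - (+ 2 + c)) * y₁ * (b₀ * + 0 + b₁ * + 0 + - (b₀ + b₁) * + 1) + + 1 * + 1
                                      ≡ d - + 2 * c + c * ((y₀ * a₀ + y₁ * b₀) + (y₀ * a₁ + y₁ * b₁)) + + 1
            ring = solve-∀
            centre : ∀ c → + (c ∸ 1) - + 2 * + c + + c * (+ 0 + + 1) + + 1 ≡ δ c 0
            centre zero    = refl
            centre (suc c) = ring′ (+ c)
              where ring′ : ∀ c → c - + 2 * (+ 1 + c) + (+ 1 + c) * (+ 0 + + 1) + + 1 ≡ + 0
                    ring′ = solve-∀
    column (suc (suc (suc s))) = trans (ring (Δ² ramp (suc (suc (suc s)))) t y₀ y₁ α₀ α₁ β₀ β₁) (ramp-Δ² c (suc s))
      where ring : ∀ d t y₀ y₁ a₀ a₁ b₀ b₁ → d + t * y₀ * (a₀ * + 0 + a₁ * + 0 + - (a₀ + a₁) * + 0)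
                                        + t * y₁ * (b₀ * + 0 + b₁ * + 0 + - (b₀ + b₁) * + 0) + + 1 * + 0 ≡ d
            ring = solve-∀

  -- The factorisation L = P D Q

  D : ℕ → ℤ
  D = basisVec (λ _ → + 1) a b (+ 0)

  L₀ L₁ Lₘ : ℕ → ℤ
  L₀ zero    = + suc (suc p)
  L₀ (suc _) = - + 1
  L₁ j = + 2 * δ 1 j - δ 2 j - δ (suc (suc p)) j
  Lₘ j = + 2 * δ (suc (suc p)) j - δ (suc p) j - δ 1 j

  L : ℕ → ℕ → ℤ
  L i j = vertexVec (L₀ j) (L₁ j) (λ r → innerRow r j) (Lₘ j) i

  basisVec-dot₃ : ∀ f x y z f' x' y' z' f'' x'' y'' z'' →
    ∑[ k < n ] (basisVec f x y z k * basisVec f' x' y' z' k * basisVec f'' x'' y'' z'' k)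
    ≡ (∑[ r < p ] (f r * f' r * f'' r)) + x * x' * x'' + y * y' * y'' + z * z' * z''
  basisVec-dot₃ f x y z f' x' y' z' f'' x'' y'' z'' =
    trans (∑-basis (λ k → basisVec f x y z k * basisVec f' x' y' z' k * basisVec f'' x'' y'' z'' k))
    (cong₂ _+_ (cong₂ _+_ (cong₂ _+_
      (∑-cong p (λ r r<p → product (basisVec-unit f x y z r<p) (basisVec-unit f' x' y' z' r<p)
                                   (basisVec-unit f'' x'' y'' z'' r<p)))
      (product (basisVec-a f x y z) (basisVec-a f' x' y' z') (basisVec-a f'' x'' y'' z'')))
      (product (basisVec-b f x y z) (basisVec-b f' x' y' z') (basisVec-b f'' x'' y'' z'')))
      (product (basisVec-0 f x y z) (basisVec-0 f' x' y' z') (basisVec-0 f'' x'' y'' z'')))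
    where
    product : ∀ {x x' y y' z z'} → x ≡ x' → y ≡ y' → z ≡ z' → x * y * z ≡ x' * y' * z'
    product x≡ y≡ z≡ = cong₂ _*_ (cong₂ _*_ x≡ y≡) z≡

  P·D·Q≡L : ∀ i j → i < n → j < n → ∑[ k < n ] (P i k * D k * Q k j) ≡ L i j
  P·D·Q≡L i j i<n j<n with vertexIndex i i<n
  ... | inner r r<p =
    trans (∑-cong n (λ k _ → trans (cong (λ x → x * D k * Q k j) (vertexVec-inner (P₀ k) (P₁ k) (λ r → δ r k) (Pₘ k) r<p))
                                   (ℤP.*-assoc (δ r k) (D k) (Q k j))))
    (trans (∑-δ n r (λ k → D k * Q k j) (<p⇒<n r<p))
    (trans (cong₂ _*_ (basisVec-unit (λ _ → + 1) a b (+ 0) r<p) (basisVec-unit (λ r → innerRow r j) (qᵃ j) (qᵇ j) (δ 2 j) r<p))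
    (trans (ℤP.*-identityˡ (innerRow r j))
           (sym (vertexVec-inner (L₀ j) (L₁ j) (λ r → innerRow r j) (Lₘ j) r<p)))))
  ... | axle =
    trans (basisVec-dot₃ (λ k → triangle (p ∸ k)) (+ 1) (+ 0) (+ 0) (λ _ → + 1) a b (+ 0) (λ r → innerRow r j) (qᵃ j) (qᵇ j) (δ 2 j))
    (trans (cong (λ s → s + + 1 * a * qᵃ j + + 0 * b * qᵇ j + + 0 * + 0 * δ 2 j) (∑-*-innerRow-vanishing p g g≥p≡0 j))
           (column j j<n))
    where
    g : ℕ → ℤ
    g r = triangle (p ∸ r) * + 1
    g≥p≡0 : ∀ r → p ≤ r → g r ≡ + 0
    g≥p≡0 r p≤r rewrite ℕP.m≤n⇒m∸n≡0 p≤r = refl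
    column : ∀ j → j < n → Δ² g j + + 1 * a * qᵃ j + + 0 * b * qᵇ j + + 0 * + 0 * δ 2 j ≡ L₀ j
    column 0 _ = trans (ring a α₀ α₁) a*α₀
      where ring : ∀ a a₀ a₁ → + 0 + + 1 * a * (a₀ * + 1 + a₁ * + 0 + - (a₀ + a₁) * + 0) + + 0 + + 0 ≡ a * a₀
            ring = solve-∀
    column 1 _ = trans (ring (triangle p) a α₀ α₁) (trans (cong (_- triangle p) a*α₁) (ring′ (triangle p)))
      where ring : ∀ t a a₀ a₁ → - (t * + 1) + + 1 * a * (a₀ * + 0 + a₁ * + 1 + - (a₀ + a₁) * + 0) + + 0 + + 0 ≡ a * a₁ - t
            ring = solve-∀
            ring′ : ∀ t → t - + 1 - t ≡ - + 1
            ring′ = solve-∀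
    column 2 _ = trans (ring (triangle p) (triangle (p ∸ 1)) a α₀ α₁)
                       (trans (cong₂ (λ x y → + 2 * triangle p - triangle (p ∸ 1) - x - y) a*α₀ a*α₁)
                       (trans (cong (λ t → + 2 * t - triangle (p ∸ 1) - + suc (suc p) - (t - + 1)) (triangle-pred p))
                              (ring′ (+ p) (triangle (p ∸ 1)))))
      where ring : ∀ t t' a a₀ a₁ → + 2 * (t * + 1) - t' * + 1 + + 1 * a * (a₀ * + 0 + a₁ * + 0 + - (a₀ + a₁) * + 1) + + 0 + + 0
                                 ≡ + 2 * t - t' - a * a₀ - a * a₁
            ring = solve-∀
            ring′ : ∀ q t → + 2 * (q + t) - t - (+ 2 + q) - (q + t - + 1) ≡ - + 1
            ring′ = solve-∀
    column (suc (suc (suc s))) (s≤s (s≤s (s≤s s<p))) =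
      trans (ring (triangle (p ∸ suc s)) (triangle (p ∸ suc (suc s))) (triangle (p ∸ s)) a α₀ α₁) (triangle-Δ² p s s<p)
      where ring : ∀ x y z a a₀ a₁ → + 2 * (x * + 1) - y * + 1 - z * + 1 + + 1 * a * (a₀ * + 0 + a₁ * + 0 + - (a₀ + a₁) * + 0)
                                   + + 0 + + 0 ≡ + 2 * x - y - z
            ring = solve-∀
  ... | rim₁ =
    trans (basisVec-dot₃ (λ k → + (p ∸ k)) u (+ 1) (+ 0) (λ _ → + 1) a b (+ 0) (λ r → innerRow r j) (qᵃ j) (qᵇ j) (δ 2 j))
    (trans (cong (λ s → s + u * a * qᵃ j + + 1 * b * qᵇ j + + 0 * + 0 * δ 2 j) (∑-*-innerRow-vanishing p g g≥p≡0 j))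
           (column j j<n))
    where
    g : ℕ → ℤ
    g r = + (p ∸ r) * + 1
    g≥p≡0 : ∀ r → p ≤ r → g r ≡ + 0
    g≥p≡0 r p≤r rewrite ℕP.m≤n⇒m∸n≡0 p≤r = refl
    column : ∀ j → j < n → Δ² g j + u * a * qᵃ j + + 1 * b * qᵇ j + + 0 * + 0 * δ 2 j ≡ L₁ j
    column 0 _ = trans (ring u a b α₀ α₁ β₀ β₁) ua*α₀+b*β₀
      where ring : ∀ u a b a₀ a₁ b₀ b₁ → + 0 + u * a * (a₀ * + 1 + a₁ * + 0 + - (a₀ + a₁) * + 0)
                                       + + 1 * b * (b₀ * + 1 + b₁ * + 0 + - (b₀ + b₁) * + 0) + + 0 ≡ u * a * a₀ + b * b₀
            ring = solve-∀
    column 1 _ = trans (ring (+ p) u a b α₀ α₁ β₀ β₁) (trans (cong (_- + p) ua*α₁+b*β₁) (ring′ (+ p)))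
      where ring : ∀ q u a b a₀ a₁ b₀ b₁ → - (q * + 1) + u * a * (a₀ * + 0 + a₁ * + 1 + - (a₀ + a₁) * + 0)
                                       + + 1 * b * (b₀ * + 0 + b₁ * + 1 + - (b₀ + b₁) * + 0) + + 0 ≡ u * a * a₁ + b * b₁ - q
            ring = solve-∀
            ring′ : ∀ q → + 2 + q - q ≡ + 2
            ring′ = solve-∀
    column 2 _ = trans (ring (+ p) (+ (p ∸ 1)) u a b α₀ α₁ β₀ β₁)
                 (trans (cong₂ (λ x y → + 2 * + p - + (p ∸ 1) - x - y) ua*α₀+b*β₀ ua*α₁+b*β₁)
                 (trans (ring′ (+ p) (+ (p ∸ 1))) (cong (λ x → - + 1 - x) (ramp-Δ² p 0))))
      where ring : ∀ q d u a b a₀ a₁ b₀ b₁ → + 2 * (q * + 1) - d * + 1 + u * a * (a₀ * + 0 + a₁ * + 0 + - (a₀ + a₁) * + 1)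
                                         + + 1 * b * (b₀ * + 0 + b₁ * + 0 + - (b₀ + b₁) * + 1) + + 0
                                         ≡ + 2 * q - d - (u * a * a₀ + b * b₀) - (u * a * a₁ + b * b₁)
            ring = solve-∀
            ring′ : ∀ q d → + 2 * q - d - + 0 - (+ 2 + q) ≡ - + 1 - (+ 2 * - q - - d - - (+ 1 + q))
            ring′ = solve-∀
    column (suc (suc (suc s))) _ =
      trans (ring (+ (p ∸ suc s)) (+ (p ∸ suc (suc s))) (+ (p ∸ s)) u a b α₀ α₁ β₀ β₁)
            (trans (cong -_ (ramp-Δ² p (suc s))) (ring′ (δ p (suc s))))
      where ring : ∀ x y z u a b a₀ a₁ b₀ b₁ → + 2 * (x * + 1) - y * + 1 - z * + 1 + u * a * (a₀ * + 0 + a₁ * + 0 + - (a₀ + a₁) * + 0)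
                                             + + 1 * b * (b₀ * + 0 + b₁ * + 0 + - (b₀ + b₁) * + 0) + + 0
                                             ≡ - (+ 2 * - x - - y - - z)
            ring = solve-∀
            ring′ : ∀ x → - x ≡ + 2 * + 0 - + 0 - x
            ring′ = solve-∀
  ... | rimₘ =
    trans (∑-cong n (λ k _ → cong (λ x → x * D k * Q k j) (vertexVec-last (P₀ k) (P₁ k) (λ r → δ r k) (Pₘ k))))
    (trans (basisVec-dot₃ (λ k → - + suc (p ∸ k)) (- u) (- + 1) (+ 1) (λ _ → + 1) a b (+ 0)
                          (λ r → innerRow r j) (qᵃ j) (qᵇ j) (δ 2 j))
    (trans (cong (λ s → s + - u * a * qᵃ j + - + 1 * b * qᵇ j + + 1 * + 0 * δ 2 j)
                 (trans (∑-cong p (λ r r<p → cong (_* innerRow r j) (g≡g̃ r<p))) (∑-*-innerRow-vanishing p g̃ g̃≥p≡0 j)))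
    (trans (column j j<n) (sym (vertexVec-last (L₀ j) (L₁ j) (λ r → innerRow r j) (Lₘ j))))))
    where
    R : ℕ → ℤ
    R t = + (p ∸ t)
    -- On r < p the coefficient −(1 + (p − r)) agrees with R (r+1) − 2 R r, which vanishes for r ≥ p.
    g̃ : ℕ → ℤ
    g̃ r = R (suc r) - + 2 * R r
    g≡g̃ : ∀ {r} → r < p → - + suc (p ∸ r) * + 1 ≡ g̃ r
    g≡g̃ {r} r<p rewrite ∸≡suc∸suc r<p = ring (+ (p ∸ suc r))
      where
      ring : ∀ x → - (+ 1 + (+ 1 + x)) * + 1 ≡ x - + 2 * (+ 1 + x)
      ring = solve-∀
    g̃≥p≡0 : ∀ r → p ≤ r → g̃ r ≡ + 0
    g̃≥p≡0 r p≤r rewrite ℕP.m≤n⇒m∸n≡0 p≤r | ℕP.m≤n⇒m∸n≡0 (ℕP.m≤n⇒m≤1+n p≤r) = refl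
    column : ∀ j → j < n → Δ² g̃ j + - u * a * qᵃ j + - + 1 * b * qᵇ j + + 1 * + 0 * δ 2 j ≡ Lₘ j
    column 0 _ = trans (ring u a b α₀ α₁ β₀ β₁) (cong -_ ua*α₀+b*β₀)
      where ring : ∀ u a b a₀ a₁ b₀ b₁ → + 0 + - u * a * (a₀ * + 1 + a₁ * + 0 + - (a₀ + a₁) * + 0)
                                       + - + 1 * b * (b₀ * + 1 + b₁ * + 0 + - (b₀ + b₁) * + 0) + + 0 ≡ - (u * a * a₀ + b * b₀)
            ring = solve-∀
    column 1 _ = trans (ring (+ p) (+ (p ∸ 1)) u a b α₀ α₁ β₀ β₁)
                 (trans (cong (λ x → + 2 * + p - + (p ∸ 1) - x) ua*α₁+b*β₁)
                 (trans (ring′ (+ p) (+ (p ∸ 1))) (cong (λ x → + 2 * + 0 - x - + 1) (ramp-Δ² p 0))))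
      where ring : ∀ q d u a b a₀ a₁ b₀ b₁ → - (d - + 2 * q) + - u * a * (a₀ * + 0 + a₁ * + 1 + - (a₀ + a₁) * + 0)
                                         + - + 1 * b * (b₀ * + 0 + b₁ * + 1 + - (b₀ + b₁) * + 0) + + 0
                                         ≡ + 2 * q - d - (u * a * a₁ + b * b₁)
            ring = solve-∀
            ring′ : ∀ q d → + 2 * q - d - (+ 2 + q) ≡ + 2 * + 0 - (+ 2 * - q - - d - - (+ 1 + q)) - + 1
            ring′ = solve-∀
    column 2 _ = trans (ring (R 0) (R 1) (R 2) u a b α₀ α₁ β₀ β₁)
                 (trans (cong₂ (λ x y → + 2 * (R 1 - + 2 * R 0) - (R 2 - + 2 * R 1) + x + y) ua*α₀+b*β₀ ua*α₁+b*β₁)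
                 (trans (ring′ (+ p) (R 1) (R 2)) (cong₂ (λ x y → + 2 * x - y - + 0) (ramp-Δ² p 0) (ramp-Δ² p 1))))
      where ring : ∀ r₀ r₁ r₂ u a b a₀ a₁ b₀ b₁ →
                  + 2 * (r₁ - + 2 * r₀) - (r₂ - + 2 * r₁) + - u * a * (a₀ * + 0 + a₁ * + 0 + - (a₀ + a₁) * + 1)
                  + - + 1 * b * (b₀ * + 0 + b₁ * + 0 + - (b₀ + b₁) * + 1) + + 0
                  ≡ + 2 * (r₁ - + 2 * r₀) - (r₂ - + 2 * r₁) + (u * a * a₀ + b * b₀) + (u * a * a₁ + b * b₁)
            ring = solve-∀
            ring′ : ∀ q r₁ r₂ → + 2 * (r₁ - + 2 * q) - (r₂ - + 2 * r₁) + + 0 + (+ 2 + q)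
                             ≡ + 2 * (+ 2 * - q - - r₁ - - (+ 1 + q)) - (+ 2 * - r₁ - - r₂ - - q) - + 0
            ring′ = solve-∀
    column (suc (suc (suc s))) _ =
      trans (ring (R s) (R (suc s)) (R (suc (suc s))) (R (suc (suc (suc s)))) u a b α₀ α₁ β₀ β₁)
            (cong₂ (λ x y → + 2 * x - y - + 0) (ramp-Δ² p (suc s)) (ramp-Δ² p (suc (suc s))))
      where ring : ∀ r₀ r₁ r₂ r₃ u a b a₀ a₁ b₀ b₁ →
                  + 2 * (r₂ - + 2 * r₁) - (r₃ - + 2 * r₂) - (r₁ - + 2 * r₀)
                  + - u * a * (a₀ * + 0 + a₁ * + 0 + - (a₀ + a₁) * + 0)
                  + - + 1 * b * (b₀ * + 0 + b₁ * + 0 + - (b₀ + b₁) * + 0) + + 0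
                  ≡ + 2 * (+ 2 * - r₁ - - r₂ - - r₀) - (+ 2 * - r₂ - - r₃ - - r₁) - + 0
            ring = solve-∀

  -- The Laplacian of W''_n

  ∑-ones : ∀ m → ∑[ k < m ] + 1 ≡ + m
  ∑-ones zero    = refl
  ∑-ones (suc m) = cong (λ s → + 1 + s) (∑-ones m)

  adjacent-inner : ∀ r s → + (if (s ≡ᵇ suc r) ∨ (r ≡ᵇ suc s) ∨ false then 1 else 0) ≡ δ r (suc s) + δ (suc r) s
  adjacent-inner zero          zero          = refl
  adjacent-inner zero          (suc zero)    = refl
  adjacent-inner zero          (suc (suc s)) = refl
  adjacent-inner (suc zero)    zero          = refl
  adjacent-inner (suc (suc r)) zero          = refl
  adjacent-inner (suc r)       (suc s)       = adjacent-inner r s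

  rimAdjacent : ℕ → ℕ → Bool
  rimAdjacent x y = (y ≡ᵇ suc x) ∨ (x ≡ᵇ suc y) ∨ ((x ≡ᵇ 1) ∧ (y ≡ᵇ suc (suc p)))
                      ∨ ((y ≡ᵇ 1) ∧ (x ≡ᵇ suc (suc p)))

  arrows : ℕ → ℕ → ℕ
  arrows zero    zero    = 0
  arrows zero    (suc _) = 1
  arrows (suc _) zero    = 0
  arrows (suc x) (suc y) = if rimAdjacent (suc x) (suc y) then 1 else 0

  wheel≡arrows : ∀ (i j : Fin n) → wheel'' n i j ≡ arrows (toℕ i) (toℕ j)
  wheel≡arrows i j with toℕ i | toℕ j
  ... | zero  | zero  = refl
  ... | zero  | suc _ = refl
  ... | suc _ | zero  = refl
  ... | suc x | suc y = cong (λ b → if b then 1 else 0) (rimAdj≡rimAdjacent (suc x) (suc y))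
    where
    rimAdj≡rimAdjacent : ∀ x y → rimAdj n x y ≡ rimAdjacent x y
    rimAdj≡rimAdjacent x y rewrite ==≡≡ᵇ y (suc x) | ==≡≡ᵇ x (suc y) | ==≡≡ᵇ x 1 | ==≡≡ᵇ y (suc (suc p))
                                 | ==≡≡ᵇ y 1 | ==≡≡ᵇ x (suc (suc p)) = refl

  lapℕ : ℕ → ℕ → ℤ
  lapℕ i j = if i ≡ᵇ j then ∑[ k < n ] + arrows i k else - + arrows i j

  laplacian≡lapℕ : ∀ (i j : Fin n) → laplacian (wheel'' n) i j ≡ lapℕ (toℕ i) (toℕ j)
  laplacian≡lapℕ i j rewrite ≟F≡≡ᵇ i j with toℕ i ≡ᵇ toℕ j
  ... | true  = trans (cong +_ (sumFinℕ-cong (wheel≡arrows i))) (sumFinℕ≡∑ n (arrows (toℕ i)))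
  ... | false = cong (λ x → - + x) (wheel≡arrows i j)

  0≢p : 0 ≢ p
  0≢p = ℕP.<⇒≢ 1≤p

  rim₁-adjacency : ∀ y → y < n → + arrows 1 y ≡ δ 2 y + δ (suc (suc p)) y
  rim₁-adjacency y y<n with vertexIndex y y<n
  ... | axle = refl
  ... | rim₁ = refl
  ... | inner r r<p rewrite ≡ᵇ-≢ (ℕP.<⇒≢ r<p) | δ-> r<p with r
  ...   | zero  = refl
  ...   | suc _ = refl
  rim₁-adjacency y y<n | rimₘ rewrite ≡ᵇ-≢ (0≢p ∘ sym) | ≡ᵇ-refl p | δ-≢ 0≢p = refl

  inner-adjacency : ∀ r → r < p → ∀ y → + arrows (suc (suc r)) y ≡ δ (suc r) y + δ (suc (suc (suc r))) y
  inner-adjacency r r<p zero          = refl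
  inner-adjacency r r<p (suc zero) rewrite ≡ᵇ-≢ (ℕP.<⇒≢ r<p) with r
  ... | zero  = refl
  ... | suc _ = refl
  inner-adjacency r r<p (suc (suc s)) = adjacent-inner r s

  rimₘ-adjacency : ∀ y → y < n → + arrows (suc (suc p)) y ≡ δ (suc p) y + δ 1 y
  rimₘ-adjacency zero          _ = refl
  rimₘ-adjacency (suc zero)    _ rewrite ≡ᵇ-≢ (0≢p ∘ sym) | ≡ᵇ-refl p = refl
  rimₘ-adjacency (suc (suc s)) (s≤s (s≤s (s≤s s≤p))) =
    trans (adjacent-inner p s) (cong (λ x → δ p (suc s) + x) (δ-> (s≤s s≤p)))

  rimRow : ∀ x a b → (∀ y → y < n → + arrows x y ≡ δ a y + δ b y) → a < n → b < n → a ≢ x → b ≢ x →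
           ∀ j → j < n → lapℕ x j ≡ + 2 * δ x j - δ a j - δ b j
  rimRow x a b adjacency a<n b<n a≢x b≢x j j<n with x ℕ.≟ j
  ... | yes refl rewrite ≡ᵇ-refl x | δ-≢ a≢x | δ-≢ b≢x =
    trans (∑-cong n adjacency) (trans (∑-+ n (δ a) (δ b)) (cong₂ _+_ (∑-δ-one a a<n) (∑-δ-one b b<n)))
    where
    ∑-δ-one : ∀ q → q < n → ∑[ k < n ] δ q k ≡ + 1
    ∑-δ-one q q<n = trans (∑-cong n (λ k _ → sym (ℤP.*-identityʳ (δ q k)))) (∑-δ n q (λ _ → + 1) q<n)
  ... | no x≢j rewrite ≡ᵇ-≢ x≢j = trans (cong -_ (adjacency j j<n)) (ring (δ a j) (δ b j))
    where
    ring : ∀ u v → - (u + v) ≡ + 2 * + 0 - u - v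
    ring = solve-∀

  lapℕ≡L : ∀ i j → i < n → j < n → lapℕ i j ≡ L i j
  lapℕ≡L i j i<n j<n with vertexIndex i i<n
  ... | axle = axle-row j
    where
    axle-row : ∀ j → lapℕ 0 j ≡ L₀ j
    axle-row zero    = trans (ℤP.+-identityˡ _) (∑-ones (suc (suc p)))
    axle-row (suc j) = refl
  ... | rim₁ = rimRow 1 2 (suc (suc p)) rim₁-adjacency 3≤n (ℕP.n<1+n _) (λ ()) (λ ()) j j<n
  ... | inner r r<p =
    trans (rimRow (suc (suc r)) (suc r) (suc (suc (suc r))) (λ y _ → inner-adjacency r r<p y)
                  (ℕP.<-trans (ℕP.n<1+n _) i<n) (s≤s (s≤s (s≤s r<p)))
                  (ℕP.<⇒≢ (ℕP.n<1+n _)) (ℕP.>⇒≢ (ℕP.n<1+n _)) j j<n)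
          (sym (vertexVec-inner (L₀ j) (L₁ j) (λ r → innerRow r j) (Lₘ j) r<p))
  ... | rimₘ =
    trans (rimRow (suc (suc p)) (suc p) 1 rimₘ-adjacency (ℕP.<-trans (ℕP.n<1+n _) i<n) (s≤s (s≤s z≤n))
                  (ℕP.<⇒≢ (ℕP.n<1+n _)) (λ ()) j j<n)
          (sym (vertexVec-last (L₀ j) (L₁ j) (λ r → innerRow r j) (Lₘ j)))

  laplacian≡L : ∀ (i j : Fin n) → laplacian (wheel'' n) i j ≡ L (toℕ i) (toℕ j)
  laplacian≡L i j = trans (laplacian≡lapℕ i j) (lapℕ≡L (toℕ i) (toℕ j) (toℕ<n i) (toℕ<n j))

  d : Fin n → ℤ
  d = snfEntries n a b

  snfEntries≡D : ∀ k → d k ≡ D (toℕ k)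
  snfEntries≡D k = entry (toℕ k) (basisIndex (toℕ k) (toℕ<n k))
    where
    entry : ∀ x → BasisIndex x →
            (if suc (suc (suc (suc x))) ℕ.≤ᵇ n then + 1 else if x == p then a else if x == suc p then b else + 0) ≡ D x
    entry x (unit r r<p) rewrite <ᵇ-true r<p = sym (basisVec-unit (λ _ → + 1) a b (+ 0) r<p)
    entry x slotᵃ rewrite <ᵇ-false (ℕP.≤-refl {p}) | ==≡≡ᵇ p p | ≡ᵇ-refl p = sym (basisVec-a (λ _ → + 1) a b (+ 0))
    entry x slotᵇ rewrite <ᵇ-false (ℕP.n≤1+n p) | ==≡≡ᵇ (suc p) p | ≡ᵇ-≢ (ℕP.1+n≢n {p})
                        | ==≡≡ᵇ (suc p) (suc p) | ≡ᵇ-refl p = sym (basisVec-b (λ _ → + 1) a b (+ 0))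
    entry x slot⁰ rewrite <ᵇ-false (ℕP.m≤n+m p 2) | ==≡≡ᵇ (suc (suc p)) p | ≡ᵇ-≢ (ℕP.>⇒≢ (ℕP.m<n+m p {2} (s≤s z≤n)))
                        | ==≡≡ᵇ (suc (suc p)) (suc p) | ≡ᵇ-≢ (ℕP.1+n≢n {suc p}) = sym (basisVec-0 (λ _ → + 1) a b (+ 0))

  d-nonneg : ∀ k → + 0 ℤ.≤ d k
  d-nonneg k = subst (+ 0 ℤ.≤_) (sym (snfEntries≡D k)) (nonneg (toℕ k) (basisIndex (toℕ k) (toℕ<n k)))
    where
    nonneg : ∀ x → BasisIndex x → + 0 ℤ.≤ D x
    nonneg x (unit r r<p) = subst (+ 0 ℤ.≤_) (sym (basisVec-unit (λ _ → + 1) a b (+ 0) r<p)) (ℤ.+≤+ z≤n)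
    nonneg x slotᵃ = subst (+ 0 ℤ.≤_) (sym (basisVec-a (λ _ → + 1) a b (+ 0))) 0≤a
    nonneg x slotᵇ = subst (+ 0 ℤ.≤_) (sym (basisVec-b (λ _ → + 1) a b (+ 0))) 0≤b
    nonneg x slot⁰ = subst (+ 0 ℤ.≤_) (sym (basisVec-0 (λ _ → + 1) a b (+ 0))) (ℤ.+≤+ z≤n)

  d-divides : ∀ i j → toℕ j ≡ suc (toℕ i) → d i ℤ∣.∣ d j
  d-divides i j j≡1+i = subst₂ ℤ∣._∣_ (sym (snfEntries≡D i)) (sym (snfEntries≡D j))
                          (chain (toℕ i) (toℕ j) (basisIndex (toℕ i) (toℕ<n i)) j≡1+i (toℕ<n j))
    where
    chain : ∀ x y → BasisIndex x → y ≡ suc x → y < n → D x ℤ∣.∣ D y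
    chain x y (unit r r<p) _    _   = subst (ℤ∣._∣ D y) (sym (basisVec-unit (λ _ → + 1) a b (+ 0) r<p)) (ℕ∣.1∣ _)
    chain x y slotᵃ        refl _   = subst₂ ℤ∣._∣_ (sym (basisVec-a (λ _ → + 1) a b (+ 0)))
                                                    (sym (basisVec-b (λ _ → + 1) a b (+ 0))) a∣b
    chain x y slotᵇ        refl _   = subst (D (suc p) ℤ∣.∣_) (sym (basisVec-0 (λ _ → + 1) a b (+ 0))) (ℕ∣._∣0 _)
    chain x y slot⁰        refl y<n = ⊥-elim (ℕP.<-irrefl refl y<n)

  L≋PDQ : laplacian (wheel'' n) ≋ ((toMatrix n P ⊗ diag d) ⊗ toMatrix n Q)
  L≋PDQ i j = trans (laplacian≡L i j)
              (trans (sym (P·D·Q≡L (toℕ i) (toℕ j) (toℕ<n i) (toℕ<n j)))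
                     (sym (toMatrix-⊗-diag n P Q D d snfEntries≡D i j)))

  slotIndex : Fin 3 → ℕ
  slotIndex 0F = suc (suc p)
  slotIndex 1F = p
  slotIndex 2F = suc p

  slotIndex<n : ∀ i → slotIndex i < n
  slotIndex<n 0F = ℕP.n<1+n _
  slotIndex<n 1F = ℕP.m<n+m p {3} (s≤s z≤n)
  slotIndex<n 2F = ℕP.m<n+m (suc p) {2} (s≤s z≤n)

  σ : Fin 3 → Fin n
  σ i = Fin.fromℕ< (slotIndex<n i)

  toℕ-σ : ∀ i → toℕ (σ i) ≡ slotIndex i
  toℕ-σ i = toℕ-fromℕ< (slotIndex<n i)

  σ-injective : ∀ {i i'} → σ i ≡ σ i' → i ≡ i'
  σ-injective {i} {i'} σi≡σi' = slotIndex-injective i i' (trans (sym (toℕ-σ i)) (trans (cong toℕ σi≡σi') (toℕ-σ i')))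
    where
    p≢1+p : p ≢ suc p
    p≢1+p = ℕP.<⇒≢ (ℕP.n<1+n p)
    p≢2+p : p ≢ suc (suc p)
    p≢2+p = ℕP.<⇒≢ (ℕP.m<n+m p {2} (s≤s z≤n))
    1+p≢2+p : suc p ≢ suc (suc p)
    1+p≢2+p = ℕP.<⇒≢ (ℕP.n<1+n (suc p))
    slotIndex-injective : ∀ i i' → slotIndex i ≡ slotIndex i' → i ≡ i'
    slotIndex-injective 0F 0F _  = refl
    slotIndex-injective 0F 1F eq = ⊥-elim (p≢2+p (sym eq))
    slotIndex-injective 0F 2F eq = ⊥-elim (1+p≢2+p (sym eq))
    slotIndex-injective 1F 0F eq = ⊥-elim (p≢2+p eq)
    slotIndex-injective 1F 1F _  = refl
    slotIndex-injective 1F 2F eq = ⊥-elim (p≢1+p eq)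
    slotIndex-injective 2F 0F eq = ⊥-elim (1+p≢2+p eq)
    slotIndex-injective 2F 1F eq = ⊥-elim (p≢1+p (sym eq))
    slotIndex-injective 2F 2F _  = refl

  dσ≡e : ∀ i → d (σ i) ≡ triple (+ 0) a b i
  dσ≡e i = trans (snfEntries≡D (σ i)) (trans (cong D (toℕ-σ i)) (slot-entry i))
    where
    slot-entry : ∀ i → D (slotIndex i) ≡ triple (+ 0) a b i
    slot-entry 0F = basisVec-0 (λ _ → + 1) a b (+ 0)
    slot-entry 1F = basisVec-a (λ _ → + 1) a b (+ 0)
    slot-entry 2F = basisVec-b (λ _ → + 1) a b (+ 0)

  slot-or-unit : ∀ r → (∃ λ i → σ i ≡ r) ⊎ d r ≡ + 1
  slot-or-unit r = classify (toℕ r) refl (basisIndex (toℕ r) (toℕ<n r))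
    where
    at : ∀ {x} i → toℕ r ≡ x → slotIndex i ≡ x → ∃ λ i → σ i ≡ r
    at i r≡x slot≡x = i , toℕ-injective (trans (toℕ-σ i) (trans slot≡x (sym r≡x)))
    classify : ∀ x → toℕ r ≡ x → BasisIndex x → (∃ λ i → σ i ≡ r) ⊎ d r ≡ + 1
    classify x r≡x (unit s s<p) = inj₂ (trans (snfEntries≡D r) (trans (cong D r≡x) (basisVec-unit (λ _ → + 1) a b (+ 0) s<p)))
    classify x r≡x slotᵃ = inj₁ (at 1F r≡x refl)
    classify x r≡x slotᵇ = inj₁ (at 2F r≡x refl)
    classify x r≡x slot⁰ = inj₁ (at 0F r≡x refl)

  smithNormalForm : IsSmithNormalForm (laplacian (wheel'' n)) (snfEntries n a b)
  smithNormalForm =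
    d-nonneg , d-divides , toMatrix n P , toMatrix n Q ,
    (toMatrix n P' , toMatrix-inverse n P P' P·P'≡δ , toMatrix-inverse n P' P P'·P≡δ) ,
    (toMatrix n Q' , toMatrix-inverse n Q Q' Q·Q'≡δ , toMatrix-inverse n Q' Q Q'·Q≡δ) ,
    L≋PDQ

  picardGroup : PicIso (wheel'' n) (triple (+ 0) a b)
  picardGroup =
    smith⇒picIso (wheel'' n) (toMatrix n P) (toMatrix n P') (toMatrix n Q) (toMatrix n Q') d
                 (toMatrix-inverse n P' P P'·P≡δ) (toMatrix-inverse n Q Q' Q·Q'≡δ) (toMatrix-inverse n Q' Q Q'·Q≡δ)
                 L≋PDQ σ σ-injective (triple (+ 0) a b) dσ≡e slot-or-unit

triangle-double : ∀ t → triangle (t ℕ.+ t) ≡ + t * (+ 2 * + t + + 1)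
triangle-double zero    = refl
triangle-double (suc t) rewrite ℕP.+-suc t t =
  trans (cong (λ s → + suc (suc (t ℕ.+ t)) + (+ suc (t ℕ.+ t) + s)) (triangle-double t)) (ring (+ t))
  where ring : ∀ c → (+ 2 + (c + c)) + ((+ 1 + (c + c)) + c * (+ 2 * c + + 1)) ≡ (+ 1 + c) * (+ 2 * (+ 1 + c) + + 1)
        ring = solve-∀

-- n = 2t + 4: A is unitriangular and a = b = n − 1.
evenCore : ∀ t → CoreData (suc (t ℕ.+ t))
evenCore t = record
  { a = m ; b = m ; u = + 0
  ; α₀ = + 1 ; α₁ = + t ; β₀ = + 0 ; β₁ = + 1
  ; x₀ = + 1 ; x₁ = - + t ; y₀ = + 0 ; y₁ = + 1
  ; AA⁻¹₀₀ = AA⁻¹₀₀′ (+ t) ; AA⁻¹₀₁ = AA⁻¹₀₁′ (+ t) ; AA⁻¹₁₀ = refl ; AA⁻¹₁₁ = refl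
  ; A⁻¹A₀₀ = A⁻¹A₀₀′ (+ t) ; A⁻¹A₀₁ = A⁻¹A₀₁′ (+ t) ; A⁻¹A₁₀ = refl ; A⁻¹A₁₁ = refl
  ; a*α₀ = ℤP.*-identityʳ m
  ; a*α₁ = trans (a*α₁′ (+ t)) (cong (λ s → + suc (t ℕ.+ t) + s - + 1) (sym (triangle-double t)))
  ; ua*α₀+b*β₀ = ua*α₀+b*β₀′ m ; ua*α₁+b*β₁ = ua*α₁+b*β₁′ m
  ; 0≤a = ℤ.+≤+ z≤n ; 0≤b = ℤ.+≤+ z≤n ; a∣b = ℕ∣.∣-refl
  }
  where
  m : ℤ
  m = + suc (suc (suc (t ℕ.+ t)))
  AA⁻¹₀₀′ : ∀ c → + 1 * + 1 + c * + 0 ≡ + 1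
  AA⁻¹₀₀′ = solve-∀
  AA⁻¹₀₁′ : ∀ c → + 1 * - c + c * + 1 ≡ + 0
  AA⁻¹₀₁′ = solve-∀
  A⁻¹A₀₀′ : ∀ c → + 1 * + 1 + - c * + 0 ≡ + 1
  A⁻¹A₀₀′ = solve-∀
  A⁻¹A₀₁′ : ∀ c → + 1 * c + - c * + 1 ≡ + 0
  A⁻¹A₀₁′ = solve-∀
  a*α₁′ : ∀ c → (+ 3 + (c + c)) * c ≡ (+ 1 + (c + c)) + c * (+ 2 * c + + 1) - + 1
  a*α₁′ = solve-∀
  ua*α₀+b*β₀′ : ∀ m → + 0 * m * + 1 + m * + 0 ≡ + 0
  ua*α₀+b*β₀′ = solve-∀
  ua*α₁+b*β₁′ : ∀ m → + 0 * m * + 1 + m * + 1 ≡ m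
  ua*α₁+b*β₁′ = solve-∀

-- n = 2g + 5: a = (n − 1)/2 = g + 2 and b = 2(n − 1).
oddCore : ∀ g → CoreData (suc (suc (g ℕ.+ g)))
oddCore g = record
  { a = + suc (suc g) ; b = + (2 ℕ.* suc (suc (suc (suc (g ℕ.+ g))))) ; u = - + 2
  ; α₀ = + 2 ; α₁ = + suc (g ℕ.+ g) ; β₀ = + 1 ; β₁ = + suc g
  ; x₀ = + suc g ; x₁ = - + suc (g ℕ.+ g) ; y₀ = - + 1 ; y₁ = + 2
  ; AA⁻¹₀₀ = AA⁻¹₀₀′ (+ g) ; AA⁻¹₀₁ = AA⁻¹₀₁′ (+ g) ; AA⁻¹₁₀ = AA⁻¹₁₀′ (+ g) ; AA⁻¹₁₁ = AA⁻¹₁₁′ (+ g)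
  ; A⁻¹A₀₀ = A⁻¹A₀₀′ (+ g) ; A⁻¹A₀₁ = A⁻¹A₀₁′ (+ g) ; A⁻¹A₁₀ = refl ; A⁻¹A₁₁ = A⁻¹A₁₁′ (+ g)
  ; a*α₀ = a*α₀′ (+ g)
  ; a*α₁ = trans (a*α₁′ (+ g)) (cong (λ s → + suc (suc (g ℕ.+ g)) + (+ suc (g ℕ.+ g) + s) - + 1) (sym (triangle-double g)))
  ; ua*α₀+b*β₀ = ua*α₀+b*β₀′ (+ g) ; ua*α₁+b*β₁ = ua*α₁+b*β₁′ (+ g)
  ; 0≤a = ℤ.+≤+ z≤n ; 0≤b = ℤ.+≤+ z≤n ; a∣b = divides 4 (b≡4a g)
  }
  where
  AA⁻¹₀₀′ : ∀ c → + 2 * (+ 1 + c) + (+ 1 + (c + c)) * - + 1 ≡ + 1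
  AA⁻¹₀₀′ = solve-∀
  AA⁻¹₀₁′ : ∀ c → + 2 * - (+ 1 + (c + c)) + (+ 1 + (c + c)) * + 2 ≡ + 0
  AA⁻¹₀₁′ = solve-∀
  AA⁻¹₁₀′ : ∀ c → + 1 * (+ 1 + c) + (+ 1 + c) * - + 1 ≡ + 0
  AA⁻¹₁₀′ = solve-∀
  AA⁻¹₁₁′ : ∀ c → + 1 * - (+ 1 + (c + c)) + (+ 1 + c) * + 2 ≡ + 1
  AA⁻¹₁₁′ = solve-∀
  A⁻¹A₀₀′ : ∀ c → (+ 1 + c) * + 2 + - (+ 1 + (c + c)) * + 1 ≡ + 1
  A⁻¹A₀₀′ = solve-∀
  A⁻¹A₀₁′ : ∀ c → (+ 1 + c) * (+ 1 + (c + c)) + - (+ 1 + (c + c)) * (+ 1 + c) ≡ + 0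
  A⁻¹A₀₁′ = solve-∀
  A⁻¹A₁₁′ : ∀ c → - + 1 * (+ 1 + (c + c)) + + 2 * (+ 1 + c) ≡ + 1
  A⁻¹A₁₁′ = solve-∀
  a*α₀′ : ∀ c → (+ 2 + c) * + 2 ≡ + 4 + (c + c)
  a*α₀′ = solve-∀
  a*α₁′ : ∀ c → (+ 2 + c) * (+ 1 + (c + c)) ≡ (+ 2 + (c + c)) + ((+ 1 + (c + c)) + c * (+ 2 * c + + 1)) - + 1
  a*α₁′ = solve-∀
  ua*α₀+b*β₀′ : ∀ c → - + 2 * (+ 2 + c) * + 2 + + 2 * (+ 4 + (c + c)) * + 1 ≡ + 0
  ua*α₀+b*β₀′ = solve-∀
  ua*α₁+b*β₁′ : ∀ c → - + 2 * (+ 2 + c) * (+ 1 + (c + c)) + + 2 * (+ 4 + (c + c)) * (+ 1 + c) ≡ + 4 + (c + c)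
  ua*α₁+b*β₁′ = solve-∀
  b≡4a : ∀ g → 2 ℕ.* suc (suc (suc (suc (g ℕ.+ g)))) ≡ 4 ℕ.* suc (suc g)
  b≡4a = ℕRing.solve-∀

module EvenWheel (t : ℕ) = SmithReduction (suc (t ℕ.+ t)) (s≤s z≤n) (evenCore t)
module OddWheel  (g : ℕ) = SmithReduction (suc (suc (g ℕ.+ g))) (s≤s z≤n) (oddCore g)

WheelPicard : ℕ → ℤ → ℤ → Set
WheelPicard n a b =
  IsSmithNormalForm (laplacian (wheel'' n)) (snfEntries n a b) × PicIso (wheel'' n) (triple (+ 0) a b)

half : ∀ g → (4 ℕ.+ (g ℕ.+ g)) / 2 ≡ 2 ℕ.+ g
half g = trans (cong (_/ 2) (double g)) (m*n/n≡m (2 ℕ.+ g) 2)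
  where
  double : ∀ g → 4 ℕ.+ (g ℕ.+ g) ≡ (2 ℕ.+ g) ℕ.* 2
  double = ℕRing.solve-∀

wheel-even : ∀ t → WheelPicard (4 ℕ.+ (t ℕ.+ t)) (+ (3 ℕ.+ (t ℕ.+ t))) (+ (3 ℕ.+ (t ℕ.+ t)))
wheel-even t = EvenWheel.smithNormalForm t , EvenWheel.picardGroup t

wheel-odd : ∀ g → WheelPicard (5 ℕ.+ (g ℕ.+ g)) (+ ((4 ℕ.+ (g ℕ.+ g)) / 2)) (+ (2 ℕ.* (4 ℕ.+ (g ℕ.+ g))))
wheel-odd g = subst (λ h → WheelPicard (5 ℕ.+ (g ℕ.+ g)) (+ h) (+ (2 ℕ.* (4 ℕ.+ (g ℕ.+ g)))))
                    (sym (half g)) (OddWheel.smithNormalForm g , OddWheel.picardGroup g)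

parity : ∀ n → (∃ λ t → n ≡ t ℕ.+ t) ⊎ (∃ λ t → n ≡ suc (t ℕ.+ t))
parity zero = inj₁ (0 , refl)
parity (suc n) with parity n
... | inj₁ (t , n≡t+t)   = inj₂ (t , cong suc n≡t+t)
... | inj₂ (t , n≡1+t+t) = inj₁ (suc t , trans (cong suc n≡1+t+t) (cong suc (sym (ℕP.+-suc t t))))

2∣t+t : ∀ t → 2 ∣ t ℕ.+ t
2∣t+t t = divides t (t+t≡t*2 t)
  where
  t+t≡t*2 : ∀ t → t ℕ.+ t ≡ t ℕ.* 2
  t+t≡t*2 = ℕRing.solve-∀

2∤1+t+t : ∀ t → ¬ 2 ∣ suc (t ℕ.+ t)
2∤1+t+t t 2∣1+t+t =
  ℕP.<-irrefl refl (ℕ∣.∣⇒≤ {1} {2} (ℕ∣.∣m+n∣m⇒∣n (subst (2 ∣_) (ℕP.+-comm 1 (t ℕ.+ t)) 2∣1+t+t) (2∣t+t t)))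

even-shape : ∀ n → 4 ≤ n → 2 ∣ n → ∃ λ t → n ≡ 4 ℕ.+ (t ℕ.+ t)
even-shape n 4≤n 2∣n with parity n
... | inj₂ (t , refl)           = ⊥-elim (2∤1+t+t t 2∣n)
... | inj₁ (zero , refl)        = ⊥-elim (ℕP.<⇒≱ (s≤s z≤n) 4≤n)
... | inj₁ (suc zero , refl)    = ⊥-elim (ℕP.<⇒≱ (s≤s (s≤s (s≤s z≤n))) 4≤n)
... | inj₁ (suc (suc t) , refl) = t , shape t
  where
  shape : ∀ t → (2 ℕ.+ t) ℕ.+ (2 ℕ.+ t) ≡ 4 ℕ.+ (t ℕ.+ t)
  shape = ℕRing.solve-∀

odd-shape : ∀ n → 4 ≤ n → ¬ 2 ∣ n → ∃ λ g → n ≡ 5 ℕ.+ (g ℕ.+ g)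
odd-shape n 4≤n 2∤n with parity n
... | inj₁ (t , refl)           = ⊥-elim (2∤n (2∣t+t t))
... | inj₂ (zero , refl)        = ⊥-elim (ℕP.<⇒≱ (s≤s (s≤s z≤n)) 4≤n)
... | inj₂ (suc zero , refl)    = ⊥-elim (ℕP.<⇒≱ (s≤s (s≤s (s≤s (s≤s z≤n)))) 4≤n)
... | inj₂ (suc (suc g) , refl) = g , shape g
  where
  shape : ∀ g → 1 ℕ.+ ((2 ℕ.+ g) ℕ.+ (2 ℕ.+ g)) ≡ 5 ℕ.+ (g ℕ.+ g)
  shape = ℕRing.solve-∀

proposition5p4 : (n : ℕ) → 4 ≤ n →
    (2 ∣ n →
      IsSmithNormalForm (laplacian (wheel'' n)) (snfEntries n (+ (n ∸ 1)) (+ (n ∸ 1)))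
      × PicIso (wheel'' n) (triple (+ 0) (+ (n ∸ 1)) (+ (n ∸ 1))))
    × (¬ (2 ∣ n) →
      IsSmithNormalForm (laplacian (wheel'' n)) (snfEntries n (+ ((n ∸ 1) / 2)) (+ (2 ℕ.* (n ∸ 1))))
      × PicIso (wheel'' n) (triple (+ 0) (+ ((n ∸ 1) / 2)) (+ (2 ℕ.* (n ∸ 1)))))
proposition5p4 n 4≤n = even , odd
  where
  even : 2 ∣ n → WheelPicard n (+ (n ∸ 1)) (+ (n ∸ 1))
  even 2∣n with even-shape n 4≤n 2∣n
  ... | t , refl = wheel-even t
  odd : ¬ 2 ∣ n → WheelPicard n (+ ((n ∸ 1) / 2)) (+ (2 ℕ.* (n ∸ 1)))
  odd 2∤n with odd-shape n 4≤n 2∤n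
  ... | g , refl = wheel-odd g
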